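{- Let $\psi_1(\mathbf{x})=\sum_{i=1}^4a_ix_i^2$, $\psi_2(\mathbf{x})=\sum_{i=1}^4 b_ix_i^2$ with $a_i,b_i\in\mathbb{Z}$. For a square-free positive integer $q$, a positive integer $c$ and $\mathbf{w}\in\mathbb{Z}^4$ define $$S_{q,c}(\mathbf{w})=\sum_{\substack{a\bmod c\\ (a,c)=1}}\ \sum_{\substack{\mathbf{k}\bmod qc\\ \psi_1(\mathbf{k})\equiv0\bmod q}}\chi_q(\psi_2(\mathbf{k}))\,e\Big(\frac{a\psi_1(\mathbf{k})+\mathbf{w}\cdot\mathbf{k}}{qc}\Big).$$ If $q=q_1q_2$ and $c=c_1c_2$ with $\gcd(q_1c_1,q_2c_2)=1$, then $S_{q,c}(\mathbf{w})=S_{q_1,c_1}(\mathbf{w})\,S_{q_2,c_2}(\mathbf{w})$.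
   Context: $e(x)=e^{2\pi i x}$. For square-free $q$, $\chi_q(n)=\prod_{p\mid q}\left(\frac{n}{p}\right)$ is the quadratic character modulo $q$ (with $\chi_1\equiv1$). The sum over $\mathbf{k}$ runs over $\mathbf{k}\in(\mathbb{Z}/qc\mathbb{Z})^4$; the summand is well defined modulo $qc$ since $\psi_1(\mathbf{k})\equiv 0\bmod q$. -}

module Defs where

open import Level using (Level)
open import Data.Bool using (Bool; true; false; if_then_else_)
open import Data.Nat as ℕ using (ℕ; zero; suc)
open import Data.Nat.Divisibility as ℕD using ()
open import Data.Nat.Primality using (Prime; prime?)
open import Data.Nat.GCD using (gcd)
open import Data.Integer as ℤ using (ℤ; +_; -[1+_]; ∣_∣)
open import Data.Rational as ℚ using (ℚ)
open import Data.List using (List; []; _∷_; upTo; filter; map; concatMap; foldr)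
open import Data.Bool.ListAction using (any)
open import Data.Vec using (Vec; []; _∷_; zipWith)
open import Relation.Nullary using (¬_; does)
open import Relation.Binary.PropositionalEquality using (_≡_)
open import Algebra.Bundles using (CommutativeRing)

_∣ℤ?_ : ℕ → ℤ → Bool
d ∣ℤ? n = does (d ℕD.∣? ∣ n ∣)

SquareFree : ℕ → Set
SquareFree q = ∀ p → Prime p → ¬ ((p ℕ.* p) ℕD.∣ q)

legendre : ℤ → ℕ → ℤ
legendre n p =
  if p ∣ℤ? n then + 0
  else if any (λ x → p ∣ℤ? ((+ x) ℤ.* (+ x) ℤ.- n)) (upTo p) then + 1
  else ℤ.- (+ 1)

primeDivisors : ℕ → List ℕ
primeDivisors q = filter (λ p → prime? p Relation.Nullary.×-dec (p ℕD.∣? q)) (upTo (suc q))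
  where import Relation.Nullary

χ : ℕ → ℤ → ℤ
χ q n = foldr (λ p r → legendre n p ℤ.* r) (+ 1) (primeDivisors q)

sumV : ∀ {m} → Vec ℤ m → ℤ
sumV []       = + 0
sumV (y ∷ ys) = y ℤ.+ sumV ys

diagForm : ∀ {n} → Vec ℤ n → Vec ℤ n → ℤ
diagForm a x = sumV (zipWith (λ aᵢ xᵢ → aᵢ ℤ.* (xᵢ ℤ.* xᵢ)) a x)

dot : ∀ {n} → Vec ℤ n → Vec ℤ n → ℤ
dot w x = sumV (zipWith ℤ._*_ w x)

-- all k ∈ {0,…,N-1}^4, i.e. representatives of (ℤ/Nℤ)^4
box4 : ℕ → List (Vec ℤ 4)
box4 N = concatMap (λ k₁ → concatMap (λ k₂ → concatMap (λ k₃ → map (λ k₄ →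
           (+ k₁) ∷ (+ k₂) ∷ (+ k₃) ∷ (+ k₄) ∷ []) (upTo N)) (upTo N)) (upTo N)) (upTo N)

-- x / d as a rational (d = 0 never occurs in use; returns 0 then)
frac : ℤ → ℕ → ℚ
frac x zero    = ℚ.0ℚ
frac x (suc d) = x ℚ./ suc d

module _ {c ℓ : Level} (R : CommutativeRing c ℓ) where
  open CommutativeRing R

  fromℕ : ℕ → Carrier
  fromℕ zero    = 0#
  fromℕ (suc n) = 1# + fromℕ n

  fromℤ : ℤ → Carrier
  fromℤ (+ n)    = fromℕ n
  fromℤ -[1+ n ] = - fromℕ (suc n)

  Σ[_]_ : ∀ {a} {A : Set a} → List A → (A → Carrier) → Carrier
  Σ[ xs ] f = foldr (λ x r → f x + r) 0# xs

  -- e : ℚ → R is an additive character of ℚ trivial on ℤ (i.e. a character of ℚ/ℤ),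
  -- abstracting x ↦ e^{2πix}
  record IsAddChar (e : ℚ → Carrier) : Set (c Level.⊔ ℓ) where
    field
      e-hom : ∀ x y → e (x ℚ.+ y) ≈ e x * e y
      e-ℤ   : ∀ (n : ℤ) → e (frac n 1) ≈ 1#

  S : (e : ℚ → Carrier) (A B : Vec ℤ 4) (q c : ℕ) (w : Vec ℤ 4) → Carrier
  S e A B q c w =
    Σ[ filter (λ a → gcd a c Data.Nat.≟ 1) (upTo c) ] λ a →
    Σ[ filter (λ k → q ℕD.∣? ∣ diagForm A k ∣) (box4 (q ℕ.* c)) ] λ k →
      fromℤ (χ q (diagForm B k)) *
      e (frac ((+ a) ℤ.* diagForm A k ℤ.+ dot w k) (q ℕ.* c))
    where import Data.Nat

{-# OPTIONS --safe #-}
module Submission where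

-- Write Mᵢ = qᵢcᵢ. The Chinese remainder theorem reindexes the a-sum modulo c₁c₂ by pairs (a₁, a₂)
-- and the k-sum modulo M₁M₂ by pairs (k₁, k₂), the lifts being chosen so that k ≡ M₂k₁ (mod M₁)
-- and aM₂ ≡ a₁ (mod c₁), and symmetrically for the second factor. Then ψ₁(k) ≡ M₂²ψ₁(k₁) (mod M₁)
-- with M₂ a unit, so the conditions (a, c) = 1 and q ∣ ψ₁(k) split into their local versions and
-- χ_q(ψ₂(k)) = χ_{q₁}(ψ₂(k₁)) χ_{q₂}(ψ₂(k₂)), since χ_q is multiplicative in q and blind to unit
-- squares. Finally, once qᵢ ∣ ψ₁(kᵢ),
--   aψ₁(k) + w·k ≡ M₂(a₁ψ₁(k₁) + w·k₁) + M₁(a₂ψ₁(k₂) + w·k₂)   (mod M₁M₂),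
-- so e(·/qc) factors as well.

open import Level using (Level)
open import Function.Base using (_∘_)
open import Function.Bundles using (mk⇔)
open import Data.Bool.Base using (Bool; true; false; if_then_else_; _∧_; T)
open import Data.Nat.Base as ℕ using (ℕ; zero; suc; NonZero; _<_; s≤s)
import Data.Nat.Properties as ℕ
open import Data.Fin.Base using (Fin; toℕ; fromℕ<)
import Data.Fin.Properties as Fin
open import Data.Fin.Permutation using (Permutation; permutation; _⟨$⟩ʳ_)
open import Data.List.Base using (List; []; _∷_; _++_; map; concatMap; filter; applyUpTo; upTo)
open import Data.Vec.Base as Vec using (Vec; []; _∷_; zipWith)
open import Relation.Nullary.Decidable using (Dec; does)
open import Relation.Unary using (Pred; Decidable)
open import Relation.Binary.PropositionalEquality as ≡ using (_≡_)
open import Algebra.Bundles using (CommutativeRing)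
open import Data.Integer.Base as ℤ using (ℤ)
open import Data.Rational.Base using (ℚ)
open import Defs renaming (Σ[_]_ to sumList)

fromℕᵛ : ∀ {d} → Vec ℕ d → Vec ℤ d
fromℕᵛ = Vec.map (λ n → ℤ.+ n)

-- Finite sums in a commutative ring

module _ {c ℓ : Level} (R : CommutativeRing c ℓ) where
  open CommutativeRing R
  open import Algebra.Properties.Semiring.Sum semiring
    using (sum; sum-cong-≋; sum-cong-≗; ∑-distrib-+; ∑-comm; sum-permute; *-distribˡ-sum; *-distribʳ-sum)
  open import Relation.Binary.Reasoning.Setoid setoid

  Σ[_]_ : ∀ {a} {A : Set a} → List A → (A → Carrier) → Carrier
  Σ[ xs ] f = sumList R xs f

  ∑< : ℕ → (ℕ → Carrier) → Carrier
  ∑< n f = sum {n} (f ∘ toℕ)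

  ∑<-cong : ∀ n {f g : ℕ → Carrier} → (∀ {i} → i < n → f i ≈ g i) → ∑< n f ≈ ∑< n g
  ∑<-cong n f≈g = sum-cong-≋ (λ i → f≈g (Fin.toℕ<n i))

  ∑<-swap : ∀ m n (f : ℕ → ℕ → Carrier) → ∑< m (λ i → ∑< n (f i)) ≈ ∑< n (λ j → ∑< m (λ i → f i j))
  ∑<-swap m n f = ∑-comm {m} {n} (λ i j → f (toℕ i) (toℕ j))

  *-distribˡ-∑< : ∀ n x (f : ℕ → Carrier) → x * ∑< n f ≈ ∑< n (λ i → x * f i)
  *-distribˡ-∑< n x f = *-distribˡ-sum {n} x (f ∘ toℕ)

  *-distribʳ-∑< : ∀ n x (f : ℕ → Carrier) → ∑< n f * x ≈ ∑< n (λ i → f i * x)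
  *-distribʳ-∑< n x f = *-distribʳ-sum {n} x (f ∘ toℕ)

  ∑<-+ : ∀ m n (f : ℕ → Carrier) → ∑< (m ℕ.+ n) f ≈ ∑< m f + ∑< n (λ i → f (m ℕ.+ i))
  ∑<-+ zero    n f = sym (+-identityˡ _)
  ∑<-+ (suc m) n f = trans (+-congˡ (∑<-+ m n (f ∘ suc))) (sym (+-assoc _ _ _))

  ∑<-* : ∀ m n (f : ℕ → Carrier) → ∑< (m ℕ.* n) f ≈ ∑< m (λ i → ∑< n (λ j → f (i ℕ.* n ℕ.+ j)))
  ∑<-* zero    n f = refl
  ∑<-* (suc m) n f = begin
    ∑< (n ℕ.+ m ℕ.* n) f
      ≈⟨ ∑<-+ n (m ℕ.* n) f ⟩
    ∑< n f + ∑< (m ℕ.* n) (λ i → f (n ℕ.+ i))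
      ≈⟨ +-congˡ (∑<-* m n (λ i → f (n ℕ.+ i))) ⟩
    ∑< n f + ∑< m (λ i → ∑< n (λ j → f (n ℕ.+ (i ℕ.* n ℕ.+ j))))
      ≡⟨ ≡.cong (∑< n f +_) (sum-cong-≗ {m} λ i → sum-cong-≗ {n} λ j →
           ≡.cong f (≡.sym (ℕ.+-assoc n (toℕ i ℕ.* n) (toℕ j)))) ⟩
    ∑< (suc m) (λ i → ∑< n (λ j → f (i ℕ.* n ℕ.+ j))) ∎

  ∑<-permute : ∀ n (f : ℕ → Carrier) (π π⁻¹ : ℕ → ℕ) →
    (∀ {i} → i < n → π i < n) → (∀ {i} → i < n → π⁻¹ i < n) →
    (∀ {i} → i < n → π (π⁻¹ i) ≡ i) → (∀ {i} → i < n → π⁻¹ (π i) ≡ i) →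
    ∑< n f ≈ ∑< n (f ∘ π)
  ∑<-permute n f π π⁻¹ π< π⁻¹< ππ⁻¹ π⁻¹π = begin
    ∑< n f                          ≈⟨ sum-permute (f ∘ toℕ) σ ⟩
    sum (λ i → f (toℕ (σ ⟨$⟩ʳ i)))  ≡⟨ sum-cong-≗ (λ i → ≡.cong f (Fin.toℕ-fromℕ< (π< (Fin.toℕ<n i)))) ⟩
    ∑< n (f ∘ π)                    ∎
    where
    lift : (g : ℕ → ℕ) → (∀ {i} → i < n → g i < n) → Fin n → Fin n
    lift g g< i = fromℕ< (g< (Fin.toℕ<n i))
    lift-inverse : ∀ g h (g< : ∀ {i} → i < n → g i < n) (h< : ∀ {i} → i < n → h i < n) →
      (∀ {i} → i < n → g (h i) ≡ i) → ∀ i → lift g g< (lift h h< i) ≡ i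
    lift-inverse g h g< h< gh i = Fin.toℕ-injective
      (≡.trans (Fin.toℕ-fromℕ< _) (≡.trans (≡.cong g (Fin.toℕ-fromℕ< _)) (gh (Fin.toℕ<n i))))
    σ : Permutation n n
    σ = permutation (lift π π<) (lift π⁻¹ π⁻¹<)
      (lift-inverse π π⁻¹ π< π⁻¹< ππ⁻¹) (lift-inverse π⁻¹ π π⁻¹< π< π⁻¹π)

  ∑box : ∀ d → ℕ → (Vec ℕ d → Carrier) → Carrier
  ∑box zero    n f = f []
  ∑box (suc d) n f = ∑< n (λ i → ∑box d n (f ∘ (i ∷_)))

  ∑box-cong : ∀ d n {f g : Vec ℕ d → Carrier} → (∀ v → f v ≈ g v) → ∑box d n f ≈ ∑box d n g
  ∑box-cong zero    n f≈g = f≈g []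
  ∑box-cong (suc d) n f≈g = ∑<-cong n (λ {i} _ → ∑box-cong d n (f≈g ∘ (i ∷_)))

  ∑<-∑box-swap : ∀ m d n (f : ℕ → Vec ℕ d → Carrier) →
    ∑< m (λ i → ∑box d n (f i)) ≈ ∑box d n (λ v → ∑< m (λ i → f i v))
  ∑<-∑box-swap m zero    n f = refl
  ∑<-∑box-swap m (suc d) n f = begin
    ∑< m (λ i → ∑< n (λ j → ∑box d n (f i ∘ (j ∷_))))
      ≈⟨ ∑<-swap m n (λ i j → ∑box d n (f i ∘ (j ∷_))) ⟩
    ∑< n (λ j → ∑< m (λ i → ∑box d n (f i ∘ (j ∷_))))
      ≈⟨ ∑<-cong n (λ {j} _ → ∑<-∑box-swap m d n (λ i → f i ∘ (j ∷_))) ⟩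
    ∑box (suc d) n (λ v → ∑< m (λ i → f i v)) ∎

  *-distribˡ-∑box : ∀ d n x (f : Vec ℕ d → Carrier) → x * ∑box d n f ≈ ∑box d n (λ v → x * f v)
  *-distribˡ-∑box zero    n x f = refl
  *-distribˡ-∑box (suc d) n x f =
    trans (*-distribˡ-∑< n x (λ i → ∑box d n (f ∘ (i ∷_))))
          (∑<-cong n (λ {i} _ → *-distribˡ-∑box d n x (f ∘ (i ∷_))))

  *-distribʳ-∑box : ∀ d n x (f : Vec ℕ d → Carrier) → ∑box d n f * x ≈ ∑box d n (λ v → f v * x)
  *-distribʳ-∑box zero    n x f = refl
  *-distribʳ-∑box (suc d) n x f =
    trans (*-distribʳ-∑< n x (λ i → ∑box d n (f ∘ (i ∷_))))
          (∑<-cong n (λ {i} _ → *-distribʳ-∑box d n x (f ∘ (i ∷_))))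

  ∑<-∑box-* : ∀ m₁ m₂ d n₁ n₂ (f g : ℕ → Vec ℕ d → Carrier) →
    ∑< m₁ (λ a₁ → ∑< m₂ (λ a₂ → ∑box d n₁ (λ k₁ → ∑box d n₂ (λ k₂ → f a₁ k₁ * g a₂ k₂)))) ≈
    ∑< m₁ (λ a → ∑box d n₁ (f a)) * ∑< m₂ (λ a → ∑box d n₂ (g a))
  ∑<-∑box-* m₁ m₂ d n₁ n₂ f g = begin
    ∑< m₁ (λ a₁ → ∑< m₂ (λ a₂ → ∑box d n₁ (λ k₁ → ∑box d n₂ (λ k₂ → f a₁ k₁ * g a₂ k₂))))
      ≈⟨ ∑<-cong m₁ (λ {a₁} _ → ∑<-cong m₂ (λ {a₂} _ → ∑box-cong d n₁ (λ k₁ →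
           sym (*-distribˡ-∑box d n₂ (f a₁ k₁) (g a₂))))) ⟩
    ∑< m₁ (λ a₁ → ∑< m₂ (λ a₂ → ∑box d n₁ (λ k₁ → f a₁ k₁ * G a₂)))
      ≈⟨ ∑<-cong m₁ (λ {a₁} _ → ∑<-cong m₂ (λ {a₂} _ → sym (*-distribʳ-∑box d n₁ (G a₂) (f a₁)))) ⟩
    ∑< m₁ (λ a₁ → ∑< m₂ (λ a₂ → F a₁ * G a₂))
      ≈⟨ ∑<-cong m₁ (λ {a₁} _ → sym (*-distribˡ-∑< m₂ (F a₁) G)) ⟩
    ∑< m₁ (λ a₁ → F a₁ * ∑< m₂ G)
      ≈⟨ *-distribʳ-∑< m₁ (∑< m₂ G) F ⟨
    ∑< m₁ F * ∑< m₂ G ∎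
    where
    F G : ℕ → Carrier
    F a = ∑box d n₁ (f a)
    G a = ∑box d n₂ (g a)

  𝟙 : Bool → Carrier
  𝟙 b = if b then 1# else 0#

  Σ-++ : ∀ {a} {A : Set a} (xs ys : List A) (f : A → Carrier) → Σ[ xs ++ ys ] f ≈ Σ[ xs ] f + Σ[ ys ] f
  Σ-++ []       ys f = sym (+-identityˡ _)
  Σ-++ (x ∷ xs) ys f = trans (+-congˡ (Σ-++ xs ys f)) (sym (+-assoc _ _ _))

  Σ-applyUpTo : ∀ n (g : ℕ → ℕ) (f : ℕ → Carrier) → Σ[ applyUpTo g n ] f ≡ ∑< n (f ∘ g)
  Σ-applyUpTo zero    g f = ≡.refl
  Σ-applyUpTo (suc n) g f = ≡.cong (f (g 0) +_) (Σ-applyUpTo n (g ∘ suc) f)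

  Σ-map : ∀ {a b} {A : Set a} {B : Set b} (h : A → B) (xs : List A) (f : B → Carrier) →
    Σ[ map h xs ] f ≡ Σ[ xs ] (f ∘ h)
  Σ-map h []       f = ≡.refl
  Σ-map h (x ∷ xs) f = ≡.cong (f (h x) +_) (Σ-map h xs f)

  Σ-concatMap : ∀ {a b} {A : Set a} {B : Set b} (h : A → List B) (xs : List A) (f : B → Carrier) →
    Σ[ concatMap h xs ] f ≈ Σ[ xs ] (λ x → Σ[ h x ] f)
  Σ-concatMap h []       f = refl
  Σ-concatMap h (x ∷ xs) f = trans (Σ-++ (h x) (concatMap h xs) f) (+-congˡ (Σ-concatMap h xs f))

  Σ-filter : ∀ {a p} {A : Set a} {P : Pred A p} (P? : Decidable P) (xs : List A) (f : A → Carrier) →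
    Σ[ filter P? xs ] f ≈ Σ[ xs ] (λ x → 𝟙 (does (P? x)) * f x)
  Σ-filter P? []       f = refl
  Σ-filter P? (x ∷ xs) f with does (P? x)
  ... | true  = +-cong (sym (*-identityˡ (f x))) (Σ-filter P? xs f)
  ... | false = trans (Σ-filter P? xs f) (sym (trans (+-congʳ (zeroˡ (f x))) (+-identityˡ _)))

  Σ-box4 : ∀ n (f : Vec ℤ 4 → Carrier) → Σ[ box4 n ] f ≈ ∑box 4 n (f ∘ fromℕᵛ)
  Σ-box4 n f =
    trans (Σ-concatMap-upTo (λ i → concatMap (λ j → concatMap (row i j) (upTo n)) (upTo n)))
    (∑<-cong n λ {i} _ → trans (Σ-concatMap-upTo (λ j → concatMap (row i j) (upTo n)))
    (∑<-cong n λ {j} _ → trans (Σ-concatMap-upTo (row i j))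
    (∑<-cong n λ {k} _ → reflexive
      (≡.trans (Σ-map (λ l → fromℕᵛ (i ∷ j ∷ k ∷ l ∷ [])) (upTo n) f) (Σ-applyUpTo n (λ l → l) _)))))
    where
    row : ℕ → ℕ → ℕ → List (Vec ℤ 4)
    row i j k = map (λ l → fromℕᵛ (i ∷ j ∷ k ∷ l ∷ [])) (upTo n)
    Σ-concatMap-upTo : ∀ (h : ℕ → List (Vec ℤ 4)) → Σ[ concatMap h (upTo n) ] f ≈ ∑< n (λ i → Σ[ h i ] f)
    Σ-concatMap-upTo h = trans (Σ-concatMap h (upTo n) f) (reflexive (Σ-applyUpTo n (λ i → i) _))

-- Congruences of integers

module _ where
  open import Data.Integer.Base using (_+_; _*_; _-_; -_; 0ℤ; 1ℤ; +_; ∣_∣)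
  import Data.Integer.Properties as ℤ
  open import Data.Integer.Divisibility.Signed
    using (_∣_; divides; ∣m∣n⇒∣m+n; ∣m⇒∣-m; ∣n⇒∣m*n; ∣-trans; ∣ᵤ⇒∣; ∣⇒∣ᵤ)
  import Data.Nat.Divisibility as ℕ
  open import Data.Integer.Tactic.RingSolver using (solve-∀)
  open import Function.Bundles using (_⇔_)
  open import Relation.Binary.Bundles using (Setoid)
  import Relation.Binary.Reasoning.Setoid

  infix 4 _≡_mod_
  record _≡_mod_ (x y : ℤ) (n : ℕ) : Set where
    constructor mod-divides
    field divides-difference : + n ∣ x - y
  open _≡_mod_ public

  ≡-mod-reflexive : ∀ {n x y} → x ≡ y → x ≡ y mod n
  ≡-mod-reflexive {x = x} ≡.refl = mod-divides (divides 0ℤ (ℤ.+-inverseʳ x))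

  ≡-mod-refl : ∀ {n x} → x ≡ x mod n
  ≡-mod-refl = ≡-mod-reflexive ≡.refl

  ≡-mod-sym : ∀ {n x y} → x ≡ y mod n → y ≡ x mod n
  ≡-mod-sym {x = x} {y} (mod-divides n∣x-y) =
    mod-divides (≡.subst (_ ∣_) (negate-difference x y) (∣m⇒∣-m n∣x-y))
    where
    negate-difference : ∀ x y → - (x - y) ≡ y - x
    negate-difference = solve-∀

  ≡-mod-trans : ∀ {n x y z} → x ≡ y mod n → y ≡ z mod n → x ≡ z mod n
  ≡-mod-trans {x = x} {y} {z} (mod-divides n∣x-y) (mod-divides n∣y-z) =
    mod-divides (≡.subst (_ ∣_) (telescope x y z) (∣m∣n⇒∣m+n n∣x-y n∣y-z))
    where
    telescope : ∀ x y z → (x - y) + (y - z) ≡ x - z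
    telescope = solve-∀

  ≡-mod-setoid : ℕ → Setoid _ _
  ≡-mod-setoid n = record
    { Carrier = ℤ
    ; _≈_ = λ x y → x ≡ y mod n
    ; isEquivalence = record { refl = ≡-mod-refl ; sym = ≡-mod-sym ; trans = ≡-mod-trans }
    }

  module ≡-mod-Reasoning (n : ℕ) = Relation.Binary.Reasoning.Setoid (≡-mod-setoid n)

  +-cong-mod : ∀ {n x y u v} → x ≡ y mod n → u ≡ v mod n → x + u ≡ y + v mod n
  +-cong-mod {x = x} {y} {u} {v} (mod-divides n∣x-y) (mod-divides n∣u-v) =
    mod-divides (≡.subst (_ ∣_) (regroup x y u v) (∣m∣n⇒∣m+n n∣x-y n∣u-v))
    where
    regroup : ∀ x y u v → (x - y) + (u - v) ≡ (x + u) - (y + v)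
    regroup = solve-∀

  *-cong-mod : ∀ {n x y u v} → x ≡ y mod n → u ≡ v mod n → x * u ≡ y * v mod n
  *-cong-mod {x = x} {y} {u} {v} (mod-divides n∣x-y) (mod-divides n∣u-v) =
    mod-divides (≡.subst (_ ∣_) (regroup x y u v) (∣m∣n⇒∣m+n (∣n⇒∣m*n x n∣u-v) (∣n⇒∣m*n v n∣x-y)))
    where
    regroup : ∀ x y u v → x * (u - v) + v * (x - y) ≡ x * u - y * v
    regroup = solve-∀

  +-congˡ-mod : ∀ {n u v} x → u ≡ v mod n → x + u ≡ x + v mod n
  +-congˡ-mod x = +-cong-mod (≡-mod-refl {x = x})

  +-congʳ-mod : ∀ {n u v} x → u ≡ v mod n → u + x ≡ v + x mod n
  +-congʳ-mod x u≡v = +-cong-mod u≡v (≡-mod-refl {x = x})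

  *-congˡ-mod : ∀ {n u v} x → u ≡ v mod n → x * u ≡ x * v mod n
  *-congˡ-mod x = *-cong-mod (≡-mod-refl {x = x})

  *-congʳ-mod : ∀ {n u v} x → u ≡ v mod n → u * x ≡ v * x mod n
  *-congʳ-mod x u≡v = *-cong-mod u≡v (≡-mod-refl {x = x})

  multiple-≡0-mod : ∀ {n} t → t * + n ≡ 0ℤ mod n
  multiple-≡0-mod {n} t = mod-divides (divides t (ℤ.+-identityʳ (t * + n)))

  ≡-mod-∣ : ∀ {d n x y} → d ℕ.∣ n → x ≡ y mod n → x ≡ y mod d
  ≡-mod-∣ d∣n (mod-divides n∣x-y) = mod-divides (∣-trans (∣ᵤ⇒∣ d∣n) n∣x-y)

  ≡0-mod⇔∣ : ∀ {n x} → x ≡ 0ℤ mod n ⇔ n ℕ.∣ ∣ x ∣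
  ≡0-mod⇔∣ {n} {x} = mk⇔
    (λ (mod-divides n∣x-0) → ∣⇒∣ᵤ (≡.subst (_ ∣_) (ℤ.+-identityʳ x) n∣x-0))
    (λ n∣x → mod-divides (≡.subst (_ ∣_) (≡.sym (ℤ.+-identityʳ x)) (∣ᵤ⇒∣ n∣x)))

  +-multiple-≡-mod : ∀ {n} x t → x + t * + n ≡ x mod n
  +-multiple-≡-mod x t = ≡-mod-trans (+-congˡ-mod x (multiple-≡0-mod t)) (≡-mod-reflexive (ℤ.+-identityʳ x))

  multiple-+-≡-mod : ∀ {n} t x → t * + n + x ≡ x mod n
  multiple-+-≡-mod t x = ≡-mod-trans (+-congʳ-mod x (multiple-≡0-mod t)) (≡-mod-reflexive (ℤ.+-identityˡ x))

  self-≡0-mod : ∀ {n} → + n ≡ 0ℤ mod n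
  self-≡0-mod {n} = mod-divides (divides 1ℤ (≡.trans (ℤ.+-identityʳ (+ n)) (≡.sym (ℤ.*-identityˡ (+ n)))))

  *-cong-mod-* : ∀ {q c x y y′} → x ≡ 0ℤ mod q → y ≡ y′ mod c → x * y ≡ x * y′ mod q ℕ.* c
  *-cong-mod-* {q} {c} {x} {y} {y′} (mod-divides q∣x-0) (mod-divides c∣y-y′) =
    mod-divides (≡.subst (_ ∣_) (factor x y y′) (∣ᵤ⇒∣ (≡.subst (q ℕ.* c ℕ.∣_) (≡.sym (ℤ.abs-* x (y - y′)))
      (ℕ.*-pres-∣ q∣x (∣⇒∣ᵤ c∣y-y′)))))
    where
    q∣x : q ℕ.∣ ∣ x ∣
    q∣x = ≡.subst (q ℕ.∣_) (≡.cong ∣_∣ (ℤ.+-identityʳ x)) (∣⇒∣ᵤ q∣x-0)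
    factor : ∀ x y y′ → x * (y - y′) ≡ x * y - x * y′
    factor = solve-∀

  cancel-inverse : ∀ {m P P′} → P * P′ ≡ 1ℤ mod m → ∀ x → P * (x * P′) ≡ x mod m
  cancel-inverse {m} {P} {P′} PP′≡1 x = begin
    P * (x * P′)  ≡⟨ regroup P x P′ ⟩
    P * P′ * x    ≈⟨ *-congʳ-mod x PP′≡1 ⟩
    1ℤ * x        ≡⟨ ℤ.*-identityˡ x ⟩
    x             ∎
    where
    open ≡-mod-Reasoning m
    regroup : ∀ P x P′ → P * (x * P′) ≡ P * P′ * x
    regroup = solve-∀

module _ where
  open import Data.Integer.Base using (_+_; _*_; _-_; -_; 0ℤ; 1ℤ; +_; ∣_∣)
  import Data.Integer.Properties as ℤ
  open import Data.Integer.DivMod using (_%ℕ_; _/ℕ_; a≡a%ℕn+[a/ℕn]*n)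
  open import Data.Integer.Divisibility.Signed
    using (_∣_; divides; ∣m∣n⇒∣m+n; ∣n⇒∣m*n; ∣-trans; ∣ᵤ⇒∣; ∣⇒∣ᵤ)
  import Data.Integer.Coprimality as ℤ
  import Data.Nat.Divisibility as ℕ
  import Data.Nat.DivMod as ℕ
  open import Data.Nat.Coprimality as ℕ using (Coprime)
  open import Data.Nat.GCD using (gcd; module Bézout)
  open import Data.Integer.Tactic.RingSolver using (solve-∀)
  open import Data.Product.Base using (∃; _×_; _,_)
  open import Data.Sum.Base using (inj₁; inj₂)
  open import Function.Bundles using (_⇔_; module Equivalence)
  open import Relation.Nullary.Negation using (contradiction)

  *-∣-coprime : ∀ {m n z} → Coprime m n → m ℕ.∣ z → n ℕ.∣ z → m ℕ.* n ℕ.∣ z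
  *-∣-coprime {m} {n} m⊥n (ℕ.divides k ≡.refl) n∣km
    with ℕ.coprime-divisor (ℕ.sym m⊥n) (≡.subst (n ℕ.∣_) (ℕ.*-comm k m) n∣km)
  ... | ℕ.divides j ≡.refl = ℕ.divides j (≡.trans (ℕ.*-assoc j n m) (≡.cong (j ℕ.*_) (ℕ.*-comm n m)))

  gcd≡1⇔coprime : ∀ {m n} → gcd m n ≡ 1 ⇔ Coprime m n
  gcd≡1⇔coprime = mk⇔ ℕ.gcd≡1⇒coprime ℕ.coprime⇒gcd≡1

  coprime-∣ˡ : ∀ {a b d} → d ℕ.∣ a → Coprime a b → Coprime d b
  coprime-∣ˡ d∣a a⊥b {i} (i∣d , i∣b) = a⊥b (ℕ.∣-trans i∣d d∣a , i∣b)

  coprime-*⇔ : ∀ {a b c} → Coprime a (b ℕ.* c) ⇔ (Coprime a b × Coprime a c)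
  coprime-*⇔ {b = b} {c} = mk⇔
    (λ a⊥bc → (λ {i} (i∣a , i∣b) → a⊥bc (i∣a , ℕ.∣m⇒∣m*n c i∣b))
            , (λ {i} (i∣a , i∣c) → a⊥bc (i∣a , ℕ.∣n⇒∣m*n b i∣c)))
    (λ (a⊥b , a⊥c) {i} (i∣a , i∣bc) →
      a⊥c (i∣a , ℕ.coprime-divisor (λ {j} (j∣i , j∣b) → a⊥b (ℕ.∣-trans j∣i i∣a , j∣b)) i∣bc))

  ≡-mod-*-coprime : ∀ {m n x y} → Coprime m n → x ≡ y mod m → x ≡ y mod n → x ≡ y mod m ℕ.* n
  ≡-mod-*-coprime m⊥n (mod-divides m∣d) (mod-divides n∣d) =
    mod-divides (∣ᵤ⇒∣ (*-∣-coprime m⊥n (∣⇒∣ᵤ m∣d) (∣⇒∣ᵤ n∣d)))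

  coprime-transfer : ∀ {m x y} v → + x ≡ v * + y mod m → Coprime x m → Coprime y m
  coprime-transfer {m} {x} {y} v x≡vy x⊥m {i} (i∣y , i∣m) = x⊥m (∣⇒∣ᵤ i∣x , i∣m)
    where
    regroup : ∀ x vy → x - vy + vy ≡ x
    regroup = solve-∀
    i∣x : + i ∣ + x
    i∣x = ≡.subst (+ i ∣_) (regroup (+ x) (v * + y))
      (∣m∣n⇒∣m+n (∣-trans (∣ᵤ⇒∣ i∣m) (divides-difference x≡vy)) (∣n⇒∣m*n v (∣ᵤ⇒∣ i∣y)))

  ≡0-mod-cancelˡ : ∀ {n} s {x} → Coprime n ∣ s ∣ → s * x ≡ 0ℤ mod n → x ≡ 0ℤ mod n
  ≡0-mod-cancelˡ s {x} n⊥s sx≡0 =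
    Equivalence.from ≡0-mod⇔∣ (ℤ.coprime-divisor (+ _) s x n⊥s (Equivalence.to ≡0-mod⇔∣ sx≡0))

  %ℕ-≡-mod : ∀ x n .{{_ : NonZero n}} → + (x %ℕ n) ≡ x mod n
  %ℕ-≡-mod x n = mod-divides (divides (- (x /ℕ n)) (begin
    + (x %ℕ n) - x                          ≡⟨ ≡.cong (λ y → + (x %ℕ n) - y) (a≡a%ℕn+[a/ℕn]*n x n) ⟩
    + (x %ℕ n) - (+ (x %ℕ n) + x /ℕ n * + n) ≡⟨ cancel (+ (x %ℕ n)) (x /ℕ n) (+ n) ⟩
    - (x /ℕ n) * + n                        ∎))
    where
    open ≡.≡-Reasoning
    cancel : ∀ r q n → r - (r + q * n) ≡ - q * n
    cancel = solve-∀

  ≡-mod⇒≡-≥ : ∀ {n i j} → i < n → j ℕ.≤ i → + i ≡ + j mod n → i ≡ j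
  ≡-mod⇒≡-≥ {n} {i} {j} i<n j≤i (mod-divides n∣i-j) =
    ℕ.≤-antisym (ℕ.m∸n≡0⇒m≤n (below-modulus (ℕ.≤-<-trans (ℕ.m∸n≤m i j) i<n) n∣i∸j)) j≤i
    where
    n∣i∸j : n ℕ.∣ i ℕ.∸ j
    n∣i∸j = ∣⇒∣ᵤ (≡.subst (_ ∣_) (≡.trans (ℤ.m-n≡m⊖n i j) (ℤ.⊖-≥ j≤i)) n∣i-j)
    below-modulus : ∀ {d} → d < n → n ℕ.∣ d → d ≡ 0
    below-modulus {zero}  _   _   = ≡.refl
    below-modulus {suc d} d<n n∣d = contradiction n∣d (ℕ.>⇒∤ d<n)

  ≡-mod⇒≡ : ∀ {n i j} → i < n → j < n → + i ≡ + j mod n → i ≡ j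
  ≡-mod⇒≡ {i = i} {j} i<n j<n i≡j with ℕ.≤-total i j
  ... | inj₁ i≤j = ≡.sym (≡-mod⇒≡-≥ j<n i≤j (≡-mod-sym i≡j))
  ... | inj₂ j≤i = ≡-mod⇒≡-≥ i<n j≤i i≡j

  inverse-mod : ∀ {a n} → Coprime a n → ∃ λ b → + a * b ≡ 1ℤ mod n
  inverse-mod {a} {n} a⊥n with ℕ.coprime-Bézout a⊥n
  ... | Bézout.+- x y eq = + x , mod-divides (divides (+ y) (begin
    + a * + x - 1ℤ           ≡⟨ ≡.cong (_- 1ℤ) (≡.trans (≡.sym (ℤ.pos-* a x)) (≡.cong +_ (ℕ.*-comm a x))) ⟩
    + (x ℕ.* a) - 1ℤ         ≡⟨ ≡.cong (λ z → + z - 1ℤ) eq ⟨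
    + (1 ℕ.+ y ℕ.* n) - 1ℤ   ≡⟨ ≡.cong (_- 1ℤ) (≡.trans (ℤ.pos-+ 1 (y ℕ.* n))
                                                         (≡.cong (λ z → 1ℤ + z) (ℤ.pos-* y n))) ⟩
    1ℤ + + y * + n - 1ℤ      ≡⟨ cancel (+ y * + n) ⟩
    + y * + n                ∎))
    where
    open ≡.≡-Reasoning
    cancel : ∀ z → 1ℤ + z - 1ℤ ≡ z
    cancel = solve-∀
  ... | Bézout.-+ x y eq = - + x , mod-divides (divides (- + y) (begin
    + a * - + x - 1ℤ         ≡⟨ negate (+ a) (+ x) ⟩
    - (1ℤ + + x * + a)       ≡⟨ ≡.cong (λ z → - (1ℤ + z)) (ℤ.pos-* x a) ⟨
    - (+ (1 ℕ.+ x ℕ.* a))    ≡⟨ ≡.cong (λ z → - + z) eq ⟩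
    - (+ (y ℕ.* n))          ≡⟨ ≡.cong -_ (ℤ.pos-* y n) ⟩
    - (+ y * + n)            ≡⟨ ℤ.neg-distribˡ-* (+ y) (+ n) ⟩
    - + y * + n              ∎))
    where
    open ≡.≡-Reasoning
    negate : ∀ a x → a * - x - 1ℤ ≡ - (1ℤ + x * a)
    negate = solve-∀

  [i*n+j]%n≡j : ∀ i {j n} .{{_ : NonZero n}} → j < n → (i ℕ.* n ℕ.+ j) ℕ.% n ≡ j
  [i*n+j]%n≡j i {j} {n} j<n = begin
    (i ℕ.* n ℕ.+ j) ℕ.% n ≡⟨ ≡.cong (ℕ._% n) (ℕ.+-comm (i ℕ.* n) j) ⟩
    (j ℕ.+ i ℕ.* n) ℕ.% n ≡⟨ ℕ.[m+kn]%n≡m%n j i n ⟩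
    j ℕ.% n               ≡⟨ ℕ.m<n⇒m%n≡m j<n ⟩
    j                     ∎
    where open ≡.≡-Reasoning

  [i*n+j]/n≡i : ∀ i {j n} .{{_ : NonZero n}} → j < n → (i ℕ.* n ℕ.+ j) ℕ./ n ≡ i
  [i*n+j]/n≡i i {j} {n} j<n = begin
    (i ℕ.* n ℕ.+ j) ℕ./ n        ≡⟨ ℕ.+-distrib-/-∣ˡ j (ℕ.n∣m*n i) ⟩
    i ℕ.* n ℕ./ n ℕ.+ j ℕ./ n    ≡⟨ ≡.cong₂ ℕ._+_ (ℕ.m*n/n≡m i n) (ℕ.m<n⇒m/n≡0 j<n) ⟩
    i ℕ.+ 0                      ≡⟨ ℕ.+-identityʳ i ⟩
    i                            ∎
    where open ≡.≡-Reasoning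

  [i*n+j]<m*n : ∀ {i j m n} → i < m → j < n → i ℕ.* n ℕ.+ j < m ℕ.* n
  [i*n+j]<m*n {i} {j} {m} {n} i<m j<n = ℕ.<-≤-trans (ℕ.+-monoʳ-< (i ℕ.* n) j<n)
    (≡.subst (ℕ._≤ m ℕ.* n) (ℕ.+-comm n (i ℕ.* n)) (ℕ.*-monoˡ-≤ n i<m))

-- The Chinese remainder theorem

module _ where
  open import Data.Integer.Base using (_+_; _*_; 0ℤ; 1ℤ; +_)
  import Data.Integer.Properties as ℤ
  open import Data.Integer.DivMod using (_%ℕ_; n%ℕd<d)
  import Data.Nat.Divisibility as ℕ
  import Data.Nat.DivMod as ℕ
  open import Data.Nat.Coprimality using (Coprime)

  module CRT {m n : ℕ} .{{_ : NonZero m}} .{{_ : NonZero n}} (m⊥n : Coprime m n)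
    {P Q P′ Q′ : ℤ} (P≡0 : P ≡ 0ℤ mod n) (Q≡0 : Q ≡ 0ℤ mod m)
    (PP′≡1 : P * P′ ≡ 1ℤ mod m) (QQ′≡1 : Q * Q′ ≡ 1ℤ mod n) where

    instance
      _ : NonZero (m ℕ.* n)
      _ = ℕ.m*n≢0 m n

    crt : ℕ → ℕ → ℕ
    crt i j = (P * + i + Q * + j) %ℕ (m ℕ.* n)

    crt< : ∀ i j → crt i j < m ℕ.* n
    crt< i j = n%ℕd<d (P * + i + Q * + j) (m ℕ.* n)

    crt-≡ : ∀ i j → + crt i j ≡ P * + i + Q * + j mod m ℕ.* n
    crt-≡ i j = %ℕ-≡-mod (P * + i + Q * + j) (m ℕ.* n)

    crt-≡ˡ : ∀ i j → + crt i j ≡ P * + i mod m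
    crt-≡ˡ i j = begin
      + crt i j           ≈⟨ ≡-mod-∣ (ℕ.m∣m*n n) (crt-≡ i j) ⟩
      P * + i + Q * + j   ≈⟨ +-congˡ-mod (P * + i) (*-congʳ-mod (+ j) Q≡0) ⟩
      P * + i + 0ℤ * + j  ≡⟨ ℤ.+-identityʳ (P * + i) ⟩
      P * + i             ∎
      where open ≡-mod-Reasoning m

    crt-≡ʳ : ∀ i j → + crt i j ≡ Q * + j mod n
    crt-≡ʳ i j = begin
      + crt i j           ≈⟨ ≡-mod-∣ (ℕ.n∣m*n m) (crt-≡ i j) ⟩
      P * + i + Q * + j   ≈⟨ +-congʳ-mod (Q * + j) (*-congʳ-mod (+ i) P≡0) ⟩
      0ℤ * + i + Q * + j  ≡⟨ ℤ.+-identityˡ (Q * + j) ⟩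
      Q * + j             ∎
      where open ≡-mod-Reasoning n

    crt-projˡ : ∀ i j → + crt i j * P′ ≡ + i mod m
    crt-projˡ i j = begin
      + crt i j * P′  ≈⟨ *-congʳ-mod P′ (crt-≡ˡ i j) ⟩
      P * + i * P′    ≡⟨ ℤ.*-assoc P (+ i) P′ ⟩
      P * (+ i * P′)  ≈⟨ cancel-inverse {P = P} {P′} PP′≡1 (+ i) ⟩
      + i             ∎
      where open ≡-mod-Reasoning m

    crt-projʳ : ∀ i j → + crt i j * Q′ ≡ + j mod n
    crt-projʳ i j = begin
      + crt i j * Q′  ≈⟨ *-congʳ-mod Q′ (crt-≡ʳ i j) ⟩
      Q * + j * Q′    ≡⟨ ℤ.*-assoc Q (+ j) Q′ ⟩
      Q * (+ j * Q′)  ≈⟨ cancel-inverse {P = Q} {Q′} QQ′≡1 (+ j) ⟩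
      + j             ∎
      where open ≡-mod-Reasoning n

    crt-unique : ∀ {i j} y → + i ≡ y * P′ mod m → + j ≡ y * Q′ mod n → + crt i j ≡ y mod m ℕ.* n
    crt-unique {i} {j} y i≡yP′ j≡yQ′ = ≡-mod-*-coprime m⊥n
      (≡-mod-trans (crt-≡ˡ i j) (≡-mod-trans (*-congˡ-mod P i≡yP′) (cancel-inverse {P = P} {P′} PP′≡1 y)))
      (≡-mod-trans (crt-≡ʳ i j) (≡-mod-trans (*-congˡ-mod Q j≡yQ′) (cancel-inverse {P = Q} {Q′} QQ′≡1 y)))

    crt⁻¹ : ℕ → ℕ
    crt⁻¹ y = ((+ y * P′) %ℕ m) ℕ.* n ℕ.+ (+ y * Q′) %ℕ n

    private
      crt′ : ℕ → ℕ
      crt′ x = crt (x ℕ./ n) (x ℕ.% n)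

      crt′< : ∀ {x} → x < m ℕ.* n → crt′ x < m ℕ.* n
      crt′< {x} _ = crt< (x ℕ./ n) (x ℕ.% n)

      crt′-index : ∀ {i j} → j < n → crt′ (i ℕ.* n ℕ.+ j) ≡ crt i j
      crt′-index {i} j<n = ≡.cong₂ crt ([i*n+j]/n≡i i j<n) ([i*n+j]%n≡j i j<n)

      crt⁻¹< : ∀ {y} → y < m ℕ.* n → crt⁻¹ y < m ℕ.* n
      crt⁻¹< {y} _ = [i*n+j]<m*n (n%ℕd<d (+ y * P′) m) (n%ℕd<d (+ y * Q′) n)

      crt′-crt⁻¹ : ∀ {y} → y < m ℕ.* n → crt′ (crt⁻¹ y) ≡ y
      crt′-crt⁻¹ {y} y<mn = ≡.trans (crt′-index (n%ℕd<d (+ y * Q′) n))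
        (≡-mod⇒≡ (crt< _ _) y<mn (crt-unique (+ y) (%ℕ-≡-mod (+ y * P′) m) (%ℕ-≡-mod (+ y * Q′) n)))

      crt⁻¹-crt′ : ∀ {x} → x < m ℕ.* n → crt⁻¹ (crt′ x) ≡ x
      crt⁻¹-crt′ {x} x<mn = begin
        crt⁻¹ (crt i j)   ≡⟨ ≡.cong₂ (λ i′ j′ → i′ ℕ.* n ℕ.+ j′) (recover-i) (recover-j) ⟩
        i ℕ.* n ℕ.+ j     ≡⟨ ℕ.+-comm (i ℕ.* n) j ⟩
        j ℕ.+ i ℕ.* n     ≡⟨ ℕ.m≡m%n+[m/n]*n x n ⟨
        x                 ∎
        where
        open ≡.≡-Reasoning
        i j : ℕ
        i = x ℕ./ n
        j = x ℕ.% n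
        recover-i : (+ crt i j * P′) %ℕ m ≡ i
        recover-i = ≡-mod⇒≡ (n%ℕd<d (+ crt i j * P′) m) (ℕ.m<n*o⇒m/o<n x<mn)
          (≡-mod-trans (%ℕ-≡-mod (+ crt i j * P′) m) (crt-projˡ i j))
        recover-j : (+ crt i j * Q′) %ℕ n ≡ j
        recover-j = ≡-mod⇒≡ (n%ℕd<d (+ crt i j * Q′) n) (ℕ.m%n<n x n)
          (≡-mod-trans (%ℕ-≡-mod (+ crt i j * Q′) n) (crt-projʳ i j))

    module _ {c ℓ : Level} (R : CommutativeRing c ℓ) where
      open CommutativeRing R using (Carrier; _≈_; setoid; refl; reflexive)
      open import Relation.Binary.Reasoning.Setoid setoid

      ∑<-crt : ∀ (f : ℕ → Carrier) → ∑< R (m ℕ.* n) f ≈ ∑< R m (λ i → ∑< R n (λ j → f (crt i j)))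
      ∑<-crt f = begin
        ∑< R (m ℕ.* n) f
          ≈⟨ ∑<-permute R (m ℕ.* n) f crt′ crt⁻¹ crt′< crt⁻¹< crt′-crt⁻¹ crt⁻¹-crt′ ⟩
        ∑< R (m ℕ.* n) (f ∘ crt′)
          ≈⟨ ∑<-* R m n (f ∘ crt′) ⟩
        ∑< R m (λ i → ∑< R n (λ j → f (crt′ (i ℕ.* n ℕ.+ j))))
          ≈⟨ ∑<-cong R m (λ {i} _ → ∑<-cong R n (λ j<n → reflexive (≡.cong f (crt′-index {i} j<n)))) ⟩
        ∑< R m (λ i → ∑< R n (λ j → f (crt i j))) ∎

      ∑box-crt : ∀ d (f : Vec ℕ d → Carrier) →
        ∑box R d (m ℕ.* n) f ≈ ∑box R d m (λ u → ∑box R d n (λ v → f (zipWith crt u v)))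
      ∑box-crt zero    f = refl
      ∑box-crt (suc d) f = begin
        ∑< R (m ℕ.* n) (λ x → ∑box R d (m ℕ.* n) (f ∘ (x ∷_)))
          ≈⟨ ∑<-cong R (m ℕ.* n) (λ {x} _ → ∑box-crt d (f ∘ (x ∷_))) ⟩
        ∑< R (m ℕ.* n) (λ x → ∑box R d m (λ u → ∑box R d n (λ v → f (x ∷ zipWith crt u v))))
          ≈⟨ ∑<-crt (λ x → ∑box R d m (λ u → ∑box R d n (λ v → f (x ∷ zipWith crt u v)))) ⟩
        ∑< R m (λ i → ∑< R n (λ j → ∑box R d m (λ u → ∑box R d n (λ v → f (crt i j ∷ zipWith crt u v)))))
          ≈⟨ ∑<-cong R m (λ {i} _ → ∑<-∑box-swap R n d m (λ j u → ∑box R d n (λ v → f (crt i j ∷ zipWith crt u v)))) ⟩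
        ∑box R (suc d) m (λ u → ∑box R (suc d) n (λ v → f (zipWith crt u v))) ∎

-- Legendre symbols and the character χ_q

module _ where
  open import Data.Integer.Base using (_*_; _-_; -_; 0ℤ; 1ℤ; +_; ∣_∣)
  import Data.Integer.Properties as ℤ
  open import Data.Integer.DivMod using (_%ℕ_; n%ℕd<d)
  open import Data.Integer.Divisibility.Signed using (∣ᵤ⇒∣; ∣⇒∣ᵤ)
  import Data.Nat.Divisibility as ℕ
  open import Data.Nat.Coprimality as ℕ using (Coprime)
  open import Data.Integer.Tactic.RingSolver using (solve-∀)
  open import Data.Product.Base using (∃; _,_; proj₁; proj₂)
  open import Data.Unit.Base using (tt)
  open import Function.Bundles using (_⇔_; module Equivalence)
  open import Function.Construct.Composition using (_⇔-∘_)
  open import Function.Construct.Symmetry using (⇔-sym)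
  open import Data.Bool.ListAction using (any)
  open import Data.List.Relation.Unary.Any.Properties using (any⁺; any⁻)
  open import Data.List.Membership.Propositional using (find; lose)
  open import Data.List.Membership.Propositional.Properties using (∈-upTo⁺)
  open import Relation.Nullary.Decidable using (does-⇔; T?; yes; no)

  T-does⇔ : ∀ {a} {A : Set a} (a? : Dec A) → T (does a?) ⇔ A
  T-does⇔ (yes a) = mk⇔ (λ _ → a) (λ _ → tt)
  T-does⇔ (no ¬a) = mk⇔ (λ ()) ¬a

  infix 4 _IsSquareMod_
  _IsSquareMod_ : ℤ → ℕ → Set
  n IsSquareMod p = ∃ λ x → x * x ≡ n mod p

  squareTest⇔IsSquareMod : ∀ n p .{{_ : NonZero p}} →
    T (any (λ x → p ∣ℤ? (+ x * + x - n)) (upTo p)) ⇔ n IsSquareMod p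
  squareTest⇔IsSquareMod n p = mk⇔ to from
    where
    to : T (any (λ x → p ∣ℤ? (+ x * + x - n)) (upTo p)) → n IsSquareMod p
    to test with x , _ , p∣x²-n ← find (any⁻ _ (upTo p) test) =
      + x , mod-divides (∣ᵤ⇒∣ (Equivalence.to (T-does⇔ (p ℕ.∣? ∣ + x * + x - n ∣)) p∣x²-n))
    from : n IsSquareMod p → T (any (λ x → p ∣ℤ? (+ x * + x - n)) (upTo p))
    from (x , x²≡n) = any⁺ _ (lose (∈-upTo⁺ (n%ℕd<d x p))
      (Equivalence.from (T-does⇔ (p ℕ.∣? ∣ y * y - n ∣)) (∣⇒∣ᵤ (divides-difference y²≡n))))
      where
      y : ℤ
      y = + (x %ℕ p)
      y²≡n : y * y ≡ n mod p
      y²≡n = ≡-mod-trans (*-cong-mod (%ℕ-≡-mod x p) (%ℕ-≡-mod x p)) x²≡n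

  module _ {p s n n′} (p⊥s : Coprime p s) (n≡s²n′ : n ≡ + s * + s * n′ mod p) where

    private
      p⊥s² : Coprime p ∣ + s * + s ∣
      p⊥s² = ≡.subst (Coprime p) (≡.sym (ℤ.abs-* (+ s) (+ s))) (Equivalence.from coprime-*⇔ (p⊥s , p⊥s))

    ≡0-mod-unit-scaling : n ≡ 0ℤ mod p ⇔ n′ ≡ 0ℤ mod p
    ≡0-mod-unit-scaling = mk⇔
      (λ n≡0 → ≡0-mod-cancelˡ (+ s * + s) p⊥s² (≡-mod-trans (≡-mod-sym n≡s²n′) n≡0))
      (λ n′≡0 → ≡-mod-trans n≡s²n′
        (≡-mod-trans (*-congˡ-mod (+ s * + s) n′≡0) (≡-mod-reflexive (ℤ.*-zeroʳ (+ s * + s)))))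

    IsSquareMod-unit-scaling : n IsSquareMod p ⇔ n′ IsSquareMod p
    IsSquareMod-unit-scaling = mk⇔
      (λ (x , x²≡n) → t * x , (begin
        t * x * (t * x)            ≡⟨ square-* t x ⟩
        t * t * (x * x)            ≈⟨ *-congˡ-mod (t * t) (≡-mod-trans x²≡n n≡s²n′) ⟩
        t * t * (+ s * + s * n′)   ≡⟨ regroup t (+ s) n′ ⟩
        (+ s * t) * (+ s * t) * n′ ≈⟨ *-congʳ-mod n′ (*-cong-mod st≡1 st≡1) ⟩
        1ℤ * 1ℤ * n′               ≡⟨ ℤ.*-identityˡ n′ ⟩
        n′                         ∎))
      (λ (y , y²≡n′) → + s * y , (begin
        + s * y * (+ s * y)        ≡⟨ square-* (+ s) y ⟩
        + s * + s * (y * y)        ≈⟨ *-congˡ-mod (+ s * + s) y²≡n′ ⟩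
        + s * + s * n′             ≈⟨ ≡-mod-sym n≡s²n′ ⟩
        n                          ∎))
      where
      open ≡-mod-Reasoning p
      t : ℤ
      t = proj₁ (inverse-mod (ℕ.sym p⊥s))
      st≡1 : + s * t ≡ 1ℤ mod p
      st≡1 = proj₂ (inverse-mod (ℕ.sym p⊥s))
      square-* : ∀ a b → a * b * (a * b) ≡ a * a * (b * b)
      square-* = solve-∀
      regroup : ∀ t s n′ → t * t * (s * s * n′) ≡ (s * t) * (s * t) * n′
      regroup = solve-∀

    legendre-unit-scaling : .{{_ : NonZero p}} → legendre n p ≡ legendre n′ p
    legendre-unit-scaling = ≡.cong₂ (λ b b′ → if b then + 0 else if b′ then + 1 else - + 1)
      (does-⇔ (≡0-mod⇔∣ ⇔-∘ (≡0-mod-unit-scaling ⇔-∘ ⇔-sym ≡0-mod⇔∣)) (p ℕ.∣? ∣ n ∣) (p ℕ.∣? ∣ n′ ∣))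
      (does-⇔ (⇔-sym (squareTest⇔IsSquareMod n′ p) ⇔-∘ (IsSquareMod-unit-scaling ⇔-∘ squareTest⇔IsSquareMod n p))
              (T? _) (T? _))

module _ where
  open import Data.Integer.Base using (_*_; 1ℤ)
  import Data.Integer.Properties as ℤ
  import Data.Nat.Divisibility as ℕ
  open import Data.Nat.Coprimality using (Coprime)
  open import Data.Nat.Primality using (Prime; prime?; ¬prime[1]; euclidsLemma)
  open import Data.Integer.Tactic.RingSolver using (solve-∀)
  open import Data.Product.Base using (_×_; _,_)
  open import Data.Sum.Base using (inj₁; inj₂)
  open import Data.List.Base using (foldr)
  open import Data.List.Properties using (filter-++; filter-accept; filter-reject; ++-identityʳ; upTo-∷ʳ)
  open import Relation.Nullary.Decidable using (yes; no; _×-dec_)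
  open import Relation.Nullary.Negation using (¬_; contradiction)

  primeDivisor? : ∀ q → Decidable (λ p → Prime p × p ℕ.∣ q)
  primeDivisor? q p = prime? p ×-dec (p ℕ.∣? q)

  χ-on : ℕ → ℤ → List ℕ → ℤ
  χ-on q n xs = foldr (λ p r → legendre n p * r) 1ℤ (filter (primeDivisor? q) xs)

  χ-on-accept : ∀ {q x} n xs → Prime x × x ℕ.∣ q → χ-on q n (x ∷ xs) ≡ legendre n x * χ-on q n xs
  χ-on-accept {q} n xs x∣q =
    ≡.cong (foldr (λ p r → legendre n p * r) 1ℤ) (filter-accept (primeDivisor? q) x∣q)

  χ-on-reject : ∀ {q x} n xs → ¬ (Prime x × x ℕ.∣ q) → χ-on q n (x ∷ xs) ≡ χ-on q n xs
  χ-on-reject {q} n xs x∤q =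
    ≡.cong (foldr (λ p r → legendre n p * r) 1ℤ) (filter-reject (primeDivisor? q) x∤q)

  χ-cong : ∀ q {n n′} → (∀ {p} → Prime p → p ℕ.∣ q → legendre n p ≡ legendre n′ p) → χ q n ≡ χ q n′
  χ-cong q {n} {n′} legendre≡ = go (upTo (suc q))
    where
    go : ∀ xs → χ-on q n xs ≡ χ-on q n′ xs
    go []       = ≡.refl
    go (x ∷ xs) with primeDivisor? q x
    ... | yes x∣q@(x-prime , x∣′q) = ≡.trans (χ-on-accept n xs x∣q)
      (≡.trans (≡.cong₂ _*_ (legendre≡ x-prime x∣′q) (go xs)) (≡.sym (χ-on-accept n′ xs x∣q)))
    ... | no x∤q = ≡.trans (χ-on-reject n xs x∤q) (≡.trans (go xs) (≡.sym (χ-on-reject n′ xs x∤q)))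

  primeDivisors-upTo : ∀ q .{{_ : NonZero q}} {N} → q < N → filter (primeDivisor? q) (upTo N) ≡ primeDivisors q
  primeDivisors-upTo q q<N with k , ≡.refl ← ℕ.m≤n⇒∃[o]m+o≡n q<N = go k
    where
    go : ∀ k → filter (primeDivisor? q) (upTo (suc q ℕ.+ k)) ≡ primeDivisors q
    go zero    = ≡.cong (filter (primeDivisor? q) ∘ upTo) (ℕ.+-identityʳ (suc q))
    go (suc k) = begin
      filter (primeDivisor? q) (upTo (suc q ℕ.+ suc k))
        ≡⟨ ≡.cong (filter (primeDivisor? q)) (≡.trans (≡.cong upTo (ℕ.+-suc (suc q) k)) (≡.sym (upTo-∷ʳ N))) ⟩
      filter (primeDivisor? q) (upTo N ++ N ∷ [])
        ≡⟨ filter-++ (primeDivisor? q) (upTo N) (N ∷ []) ⟩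
      filter (primeDivisor? q) (upTo N) ++ filter (primeDivisor? q) (N ∷ [])
        ≡⟨ ≡.cong (filter (primeDivisor? q) (upTo N) ++_) (filter-reject (primeDivisor? q) N∤q) ⟩
      filter (primeDivisor? q) (upTo N) ++ []
        ≡⟨ ++-identityʳ _ ⟩
      filter (primeDivisor? q) (upTo N)
        ≡⟨ go k ⟩
      primeDivisors q ∎
      where
      open ≡.≡-Reasoning
      N : ℕ
      N = suc q ℕ.+ k
      N∤q : ¬ (Prime N × N ℕ.∣ q)
      N∤q (_ , N∣q) = ℕ.<⇒≱ (ℕ.m≤m+n (suc q) k) (ℕ.∣⇒≤ N∣q)

  χ-on-* : ∀ {q₁ q₂} → Coprime q₁ q₂ → ∀ n xs → χ-on (q₁ ℕ.* q₂) n xs ≡ χ-on q₁ n xs * χ-on q₂ n xs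
  χ-on-* q₁⊥q₂ n []       = ≡.refl
  χ-on-* {q₁} {q₂} q₁⊥q₂ n (x ∷ xs) with primeDivisor? q₁ x | primeDivisor? q₂ x | χ-on-* q₁⊥q₂ n xs
  ... | yes (x-prime , x∣q₁) | yes (_ , x∣q₂) | _ =
    contradiction (≡.subst Prime (q₁⊥q₂ (x∣q₁ , x∣q₂)) x-prime) ¬prime[1]
  ... | yes D₁@(x-prime , x∣q₁) | no ¬D₂ | rec = begin
    χ-on (q₁ ℕ.* q₂) n (x ∷ xs)                ≡⟨ χ-on-accept n xs (x-prime , ℕ.∣m⇒∣m*n q₂ x∣q₁) ⟩
    L * χ-on (q₁ ℕ.* q₂) n xs                  ≡⟨ ≡.cong (L *_) rec ⟩
    L * (χ-on q₁ n xs * χ-on q₂ n xs)          ≡⟨ ℤ.*-assoc L (χ-on q₁ n xs) (χ-on q₂ n xs) ⟨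
    L * χ-on q₁ n xs * χ-on q₂ n xs            ≡⟨ ≡.cong₂ _*_ (χ-on-accept n xs D₁) (χ-on-reject n xs ¬D₂) ⟨
    χ-on q₁ n (x ∷ xs) * χ-on q₂ n (x ∷ xs)    ∎
    where
    open ≡.≡-Reasoning
    L : ℤ
    L = legendre n x
  ... | no ¬D₁ | yes D₂@(x-prime , x∣q₂) | rec = begin
    χ-on (q₁ ℕ.* q₂) n (x ∷ xs)                ≡⟨ χ-on-accept n xs (x-prime , ℕ.∣n⇒∣m*n q₁ x∣q₂) ⟩
    L * χ-on (q₁ ℕ.* q₂) n xs                  ≡⟨ ≡.cong (L *_) rec ⟩
    L * (χ-on q₁ n xs * χ-on q₂ n xs)          ≡⟨ commute L (χ-on q₁ n xs) (χ-on q₂ n xs) ⟩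
    χ-on q₁ n xs * (L * χ-on q₂ n xs)          ≡⟨ ≡.cong₂ _*_ (χ-on-reject n xs ¬D₁) (χ-on-accept n xs D₂) ⟨
    χ-on q₁ n (x ∷ xs) * χ-on q₂ n (x ∷ xs)    ∎
    where
    open ≡.≡-Reasoning
    L : ℤ
    L = legendre n x
    commute : ∀ a b c → a * (b * c) ≡ b * (a * c)
    commute = solve-∀
  ... | no ¬D₁ | no ¬D₂ | rec =
    ≡.trans (χ-on-reject n xs ¬D₁₂)
      (≡.trans rec (≡.sym (≡.cong₂ _*_ (χ-on-reject n xs ¬D₁) (χ-on-reject n xs ¬D₂))))
    where
    ¬D₁₂ : ¬ (Prime x × x ℕ.∣ q₁ ℕ.* q₂)
    ¬D₁₂ (x-prime , x∣q₁q₂) with euclidsLemma q₁ q₂ x-prime x∣q₁q₂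
    ... | inj₁ x∣q₁ = ¬D₁ (x-prime , x∣q₁)
    ... | inj₂ x∣q₂ = ¬D₂ (x-prime , x∣q₂)

  χ-* : ∀ {q₁ q₂} .{{_ : NonZero q₁}} .{{_ : NonZero q₂}} → Coprime q₁ q₂ → ∀ n →
    χ (q₁ ℕ.* q₂) n ≡ χ q₁ n * χ q₂ n
  χ-* {q₁} {q₂} q₁⊥q₂ n = ≡.trans (χ-on-* q₁⊥q₂ n (upTo (suc (q₁ ℕ.* q₂))))
    (≡.cong₂ (λ xs ys → χ-on′ xs * χ-on′ ys)
      (primeDivisors-upTo q₁ (s≤s (ℕ.m≤m*n q₁ q₂)))
      (primeDivisors-upTo q₂ (s≤s (ℕ.m≤n*m q₂ q₁))))
    where
    χ-on′ : List ℕ → ℤ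
    χ-on′ = foldr (λ p r → legendre n p * r) 1ℤ

-- The additive character

module _ where
  open import Data.Integer.Base using (_+_; _*_; 1ℤ; +_)
  open import Data.Integer.Tactic.RingSolver using (solve-∀)
  open import Data.Rational.Base as ℚ using (ℚ; toℚᵘ; fromℚᵘ)
  import Data.Rational.Properties as ℚ
  import Data.Rational.Unnormalised.Base as ℚᵘ
  import Data.Rational.Unnormalised.Properties as ℚᵘ

  fromℚᵘ-homo-+ : ∀ p q → fromℚᵘ (p ℚᵘ.+ q) ≡ fromℚᵘ p ℚ.+ fromℚᵘ q
  fromℚᵘ-homo-+ p q = ℚ.toℚᵘ-injective (ℚᵘ.≃-trans (ℚ.toℚᵘ-fromℚᵘ (p ℚᵘ.+ q))
    (ℚᵘ.≃-sym (ℚᵘ.≃-trans (ℚ.toℚᵘ-homo-+ (fromℚᵘ p) (fromℚᵘ q))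
      (ℚᵘ.+-cong (ℚ.toℚᵘ-fromℚᵘ p) (ℚ.toℚᵘ-fromℚᵘ q)))))

  frac-+ : ∀ {M₁ M₂} → 0 < M₁ → 0 < M₂ → ∀ X₁ X₂ t →
    frac (X₁ * + M₂ + X₂ * + M₁ + t * + (M₁ ℕ.* M₂)) (M₁ ℕ.* M₂) ≡
      frac X₁ M₁ ℚ.+ frac X₂ M₂ ℚ.+ frac t 1
  frac-+ {suc d₁} {suc d₂} _ _ X₁ X₂ t = begin
    fromℚᵘ (ℚᵘ.mkℚᵘ (Y + t * K) (d₂ ℕ.+ d₁ ℕ.* suc d₂))
      ≡⟨ ℚ.fromℚᵘ-cong {ℚᵘ.mkℚᵘ (Y + t * K) _} {x₁ ℚᵘ.+ x₂ ℚᵘ.+ ℚᵘ.mkℚᵘ t 0} (ℚᵘ.*≡* cross-multiplied) ⟩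
    fromℚᵘ (x₁ ℚᵘ.+ x₂ ℚᵘ.+ ℚᵘ.mkℚᵘ t 0)
      ≡⟨ fromℚᵘ-homo-+ (x₁ ℚᵘ.+ x₂) (ℚᵘ.mkℚᵘ t 0) ⟩
    fromℚᵘ (x₁ ℚᵘ.+ x₂) ℚ.+ frac t 1
      ≡⟨ ≡.cong (ℚ._+ frac t 1) (fromℚᵘ-homo-+ x₁ x₂) ⟩
    frac X₁ (suc d₁) ℚ.+ frac X₂ (suc d₂) ℚ.+ frac t 1 ∎
    where
    open ≡.≡-Reasoning
    x₁ x₂ : ℚᵘ.ℚᵘ
    x₁ = ℚᵘ.mkℚᵘ X₁ d₁
    x₂ = ℚᵘ.mkℚᵘ X₂ d₂
    Y K : ℤ
    Y = X₁ * + suc d₂ + X₂ * + suc d₁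
    K = + (suc d₁ ℕ.* suc d₂)
    regroup : ∀ Y t K → (Y + t * K) * K ≡ (Y * 1ℤ + t * K) * K
    regroup = solve-∀
    cross-multiplied : (Y + t * K) * + (suc d₁ ℕ.* suc d₂ ℕ.* 1) ≡ (Y * 1ℤ + t * K) * K
    cross-multiplied = ≡.trans (≡.cong (λ n → (Y + t * K) * + n) (ℕ.*-identityʳ _)) (regroup Y t K)

module _ {c ℓ : Level} (R : CommutativeRing c ℓ) where
  open CommutativeRing R
  open import Algebra.Properties.Ring ring using (-1*x≈-x; -‿involutive)
  open import Algebra.Properties.CommutativeSemigroup *-commutativeSemigroup using (interchange)
  open import Relation.Binary.Reasoning.Setoid setoid
  open import Data.Sign.Base as Sign using (Sign)
  open import Data.Integer.Properties as ℤ using (◃-inverse)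
  open import Data.Integer.Base using (_◃_; sign; ∣_∣)
  open import Data.Rational.Base as ℚ using (ℚ)
  open import Data.Integer.Divisibility.Signed using (divides)
  open import Data.Integer.Tactic.RingSolver using (solve-∀)

  fromℕ-+ : ∀ m n → fromℕ R (m ℕ.+ n) ≈ fromℕ R m + fromℕ R n
  fromℕ-+ zero    n = sym (+-identityˡ _)
  fromℕ-+ (suc m) n = trans (+-congˡ (fromℕ-+ m n)) (sym (+-assoc _ _ _))

  fromℕ-* : ∀ m n → fromℕ R (m ℕ.* n) ≈ fromℕ R m * fromℕ R n
  fromℕ-* zero    n = sym (zeroˡ _)
  fromℕ-* (suc m) n = begin
    fromℕ R (n ℕ.+ m ℕ.* n)             ≈⟨ fromℕ-+ n (m ℕ.* n) ⟩
    fromℕ R n + fromℕ R (m ℕ.* n)       ≈⟨ +-cong (sym (*-identityˡ _)) (fromℕ-* m n) ⟩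
    1# * fromℕ R n + fromℕ R m * fromℕ R n ≈⟨ distribʳ _ _ _ ⟨
    (1# + fromℕ R m) * fromℕ R n         ∎

  signValue : Sign → Carrier
  signValue Sign.+ = 1#
  signValue Sign.- = - 1#

  signValue-* : ∀ s t → signValue (s Sign.* t) ≈ signValue s * signValue t
  signValue-* Sign.+ t      = sym (*-identityˡ _)
  signValue-* Sign.- Sign.+ = sym (*-identityʳ _)
  signValue-* Sign.- Sign.- = sym (trans (-1*x≈-x (- 1#)) (-‿involutive 1#))

  fromℤ-◃ : ∀ s n → fromℤ R (s ◃ n) ≈ signValue s * fromℕ R n
  fromℤ-◃ s      zero    = sym (zeroʳ _)
  fromℤ-◃ Sign.+ (suc n) = sym (*-identityˡ _)
  fromℤ-◃ Sign.- (suc n) = sym (-1*x≈-x _)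

  fromℤ-* : ∀ i j → fromℤ R (i ℤ.* j) ≈ fromℤ R i * fromℤ R j
  fromℤ-* i j = begin
    fromℤ R (sign i Sign.* sign j ◃ ∣ i ∣ ℕ.* ∣ j ∣)
      ≈⟨ fromℤ-◃ (sign i Sign.* sign j) (∣ i ∣ ℕ.* ∣ j ∣) ⟩
    signValue (sign i Sign.* sign j) * fromℕ R (∣ i ∣ ℕ.* ∣ j ∣)
      ≈⟨ *-cong (signValue-* (sign i) (sign j)) (fromℕ-* ∣ i ∣ ∣ j ∣) ⟩
    (signValue (sign i) * signValue (sign j)) * (fromℕ R ∣ i ∣ * fromℕ R ∣ j ∣)
      ≈⟨ interchange _ _ _ _ ⟩
    (signValue (sign i) * fromℕ R ∣ i ∣) * (signValue (sign j) * fromℕ R ∣ j ∣)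
      ≈⟨ *-cong (fromℤ-◃ (sign i) ∣ i ∣) (fromℤ-◃ (sign j) ∣ j ∣) ⟨
    fromℤ R (sign i ◃ ∣ i ∣) * fromℤ R (sign j ◃ ∣ j ∣)
      ≡⟨ ≡.cong₂ (λ i′ j′ → fromℤ R i′ * fromℤ R j′) (◃-inverse i) (◃-inverse j) ⟩
    fromℤ R i * fromℤ R j ∎

  𝟙-∧-* : ∀ b₁ b₂ {x x₁ x₂} → (T b₁ → T b₂ → x ≈ x₁ * x₂) →
    𝟙 R (b₁ ∧ b₂) * x ≈ (𝟙 R b₁ * x₁) * (𝟙 R b₂ * x₂)
  𝟙-∧-* true  true  x≈ = trans (*-identityˡ _) (trans (x≈ _ _) (sym (*-cong (*-identityˡ _) (*-identityˡ _))))
  𝟙-∧-* true  false x≈ = trans (zeroˡ _) (sym (trans (*-congˡ (zeroˡ _)) (zeroʳ _)))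
  𝟙-∧-* false b₂    x≈ = trans (zeroˡ _) (sym (trans (*-congʳ (zeroˡ _)) (zeroˡ _)))

  module _ {e : ℚ → Carrier} (e-char : IsAddChar R e) where
    open IsAddChar e-char

    e-frac-split : ∀ {M₁ M₂} → 0 < M₁ → 0 < M₂ → ∀ {X} X₁ X₂ →
      X ≡ X₁ ℤ.* ℤ.+ M₂ ℤ.+ X₂ ℤ.* ℤ.+ M₁ mod M₁ ℕ.* M₂ →
      e (frac X (M₁ ℕ.* M₂)) ≈ e (frac X₁ M₁) * e (frac X₂ M₂)
    e-frac-split {M₁} {M₂} 0<M₁ 0<M₂ {X} X₁ X₂ (mod-divides (divides t X-Y≡tM)) = begin
      e (frac X (M₁ ℕ.* M₂))                              ≡⟨ ≡.cong (λ z → e (frac z (M₁ ℕ.* M₂))) X≡Y+tM ⟩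
      e (frac (Y ℤ.+ t ℤ.* ℤ.+ (M₁ ℕ.* M₂)) (M₁ ℕ.* M₂))  ≡⟨ ≡.cong e (frac-+ 0<M₁ 0<M₂ X₁ X₂ t) ⟩
      e (frac X₁ M₁ ℚ.+ frac X₂ M₂ ℚ.+ frac t 1)          ≈⟨ e-hom _ _ ⟩
      e (frac X₁ M₁ ℚ.+ frac X₂ M₂) * e (frac t 1)        ≈⟨ *-cong (e-hom _ _) (e-ℤ t) ⟩
      e (frac X₁ M₁) * e (frac X₂ M₂) * 1#                ≈⟨ *-identityʳ _ ⟩
      e (frac X₁ M₁) * e (frac X₂ M₂)                     ∎
      where
      Y : ℤ
      Y = X₁ ℤ.* ℤ.+ M₂ ℤ.+ X₂ ℤ.* ℤ.+ M₁
      X≡Y+tM : X ≡ Y ℤ.+ t ℤ.* ℤ.+ (M₁ ℕ.* M₂)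
      X≡Y+tM = ≡.trans (split X Y) (≡.cong (λ z → Y ℤ.+ z) X-Y≡tM)
        where
        split : ∀ X Y → X ≡ Y ℤ.+ (X ℤ.- Y)
        split = solve-∀

-- Diagonal quadratic forms

module _ where
  open import Data.Integer.Base using (_+_; _*_)
  import Data.Integer.Properties as ℤ
  open import Data.Integer.Tactic.RingSolver using (solve-∀)
  import Data.Nat.Divisibility as ℕ
  open import Data.Vec.Relation.Binary.Pointwise.Inductive as Pointwise using (Pointwise; []; _∷_)

  infix 4 _≡ᵛ_mod_
  _≡ᵛ_mod_ : ∀ {d} → Vec ℤ d → Vec ℤ d → ℕ → Set
  x ≡ᵛ y mod n = Pointwise (λ xᵢ yᵢ → xᵢ ≡ yᵢ mod n) x y

  ≡ᵛ-mod-∣ : ∀ {d m n} {x y : Vec ℤ d} → m ℕ.∣ n → x ≡ᵛ y mod n → x ≡ᵛ y mod m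
  ≡ᵛ-mod-∣ m∣n = Pointwise.map (≡-mod-∣ m∣n)

  diagForm-cong-mod : ∀ {d n} (a : Vec ℤ d) {x y} → x ≡ᵛ y mod n → diagForm a x ≡ diagForm a y mod n
  diagForm-cong-mod []      []              = ≡-mod-refl
  diagForm-cong-mod (aᵢ ∷ a) (xᵢ≡yᵢ ∷ x≡y) =
    +-cong-mod (*-congˡ-mod aᵢ (*-cong-mod xᵢ≡yᵢ xᵢ≡yᵢ)) (diagForm-cong-mod a x≡y)

  dot-cong-mod : ∀ {d n} (w : Vec ℤ d) {x y} → x ≡ᵛ y mod n → dot w x ≡ dot w y mod n
  dot-cong-mod []       []              = ≡-mod-refl
  dot-cong-mod (wᵢ ∷ w) (xᵢ≡yᵢ ∷ x≡y) = +-cong-mod (*-congˡ-mod wᵢ xᵢ≡yᵢ) (dot-cong-mod w x≡y)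

  diagForm-scale : ∀ {d} (a : Vec ℤ d) s x → diagForm a (Vec.map (s *_) x) ≡ s * s * diagForm a x
  diagForm-scale []       s []       = ≡.sym (ℤ.*-zeroʳ (s * s))
  diagForm-scale (aᵢ ∷ a) s (xᵢ ∷ x) =
    ≡.trans (≡.cong (aᵢ * (s * xᵢ * (s * xᵢ)) +_) (diagForm-scale a s x)) (regroup aᵢ s xᵢ (diagForm a x))
    where
    regroup : ∀ a s x r → a * (s * x * (s * x)) + s * s * r ≡ s * s * (a * (x * x) + r)
    regroup = solve-∀

  diagForm-≡-scaled : ∀ {d n} (a : Vec ℤ d) s {x} y → x ≡ᵛ Vec.map (s *_) y mod n →
    diagForm a x ≡ s * s * diagForm a y mod n
  diagForm-≡-scaled a s y x≡sy = ≡-mod-trans (diagForm-cong-mod a x≡sy) (≡-mod-reflexive (diagForm-scale a s y))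

  dot-scale : ∀ {d} (w : Vec ℤ d) s x → dot w (Vec.map (s *_) x) ≡ s * dot w x
  dot-scale []       s []       = ≡.sym (ℤ.*-zeroʳ s)
  dot-scale (wᵢ ∷ w) s (xᵢ ∷ x) =
    ≡.trans (≡.cong (wᵢ * (s * xᵢ) +_) (dot-scale w s x)) (regroup wᵢ s xᵢ (dot w x))
    where
    regroup : ∀ w s x r → w * (s * x) + s * r ≡ s * (w * x + r)
    regroup = solve-∀

  dot-≡-scaled : ∀ {d n} (w : Vec ℤ d) s {x} y → x ≡ᵛ Vec.map (s *_) y mod n → dot w x ≡ s * dot w y mod n
  dot-≡-scaled w s y x≡sy = ≡-mod-trans (dot-cong-mod w x≡sy) (≡-mod-reflexive (dot-scale w s y))

-- The exponential sum

module ExponentialSum {c ℓ : Level} (R : CommutativeRing c ℓ) {e : ℚ → CommutativeRing.Carrier R}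
         (e-char : IsAddChar R e) (A B w : Vec ℤ 4) where
  open CommutativeRing R
  import Relation.Binary.Reasoning.Setoid setoid as ≈-Reasoning
  open import Data.Nat.GCD using (gcd)
  import Data.Nat.Divisibility as ℕ
  open import Data.Nat.Coprimality as ℕ using (Coprime)
  open import Data.Nat.Primality using (prime⇒nonZero)
  open import Data.Integer.Base using (∣_∣)
  import Data.Integer.Properties as ℤ
  open import Data.Integer.Tactic.RingSolver using (solve-∀)
  open import Function.Bundles using (_⇔_; mk⇔; module Equivalence)
  open import Function.Construct.Composition using (_⇔-∘_)
  open import Function.Construct.Symmetry using (⇔-sym)
  open import Data.Product.Base using (∃; _×_; _,_; proj₁; proj₂)
  open import Data.Product.Function.NonDependent.Propositional using (_×-⇔_)
  open import Data.Vec.Relation.Binary.Pointwise.Inductive using ([]; _∷_)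
  open import Relation.Nullary.Decidable using (does-⇔; _×-dec_)

  phase : ℕ → Vec ℤ 4 → ℤ
  phase a k = ℤ.+ a ℤ.* diagForm A k ℤ.+ dot w k

  term : (q c a : ℕ) → Vec ℤ 4 → Carrier
  term q c a k = fromℤ R (χ q (diagForm B k)) * e (frac (phase a k) (q ℕ.* c))

  summand : (q c a : ℕ) → Vec ℤ 4 → Carrier
  summand q c a k = 𝟙 R (does (gcd a c ℕ.≟ 1)) * (𝟙 R (does (q ℕ.∣? ∣ diagForm A k ∣)) * term q c a k)

  S≈∑summand : ∀ q c → S R e A B q c w ≈ ∑< R c (λ a → ∑box R 4 (q ℕ.* c) (summand q c a ∘ fromℕᵛ))
  S≈∑summand q c = begin
    S R e A B q c w
      ≈⟨ Σ-filter R (λ a → gcd a c ℕ.≟ 1) (upTo c) _ ⟩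
    Σ[_]_ R (upTo c) (λ a → g a * Σ[_]_ R (filter q∣ψ₁? box) (term q c a))
      ≡⟨ Σ-applyUpTo R c (λ a → a) _ ⟩
    ∑< R c (λ a → g a * Σ[_]_ R (filter q∣ψ₁? box) (term q c a))
      ≈⟨ ∑<-cong R c (λ {a} _ → *-congˡ {g a}
           (trans (Σ-filter R q∣ψ₁? box (term q c a)) (Σ-box4 R (q ℕ.* c) (λ k → d k * term q c a k)))) ⟩
    ∑< R c (λ a → g a * ∑box R 4 (q ℕ.* c) (λ k → d (fromℕᵛ k) * term q c a (fromℕᵛ k)))
      ≈⟨ ∑<-cong R c (λ {a} _ → *-distribˡ-∑box R 4 (q ℕ.* c) (g a) (λ k → d (fromℕᵛ k) * term q c a (fromℕᵛ k))) ⟩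
    ∑< R c (λ a → ∑box R 4 (q ℕ.* c) (summand q c a ∘ fromℕᵛ)) ∎
    where
    open ≈-Reasoning
    box : List (Vec ℤ 4)
    box = box4 (q ℕ.* c)
    q∣ψ₁? : (k : Vec ℤ 4) → Dec (q ℕ.∣ ∣ diagForm A k ∣)
    q∣ψ₁? k = q ℕ.∣? ∣ diagForm A k ∣
    g : ℕ → Carrier
    g a = 𝟙 R (does (gcd a c ℕ.≟ 1))
    d : Vec ℤ 4 → Carrier
    d k = 𝟙 R (does (q∣ψ₁? k))

  module _ {q M : ℕ} (q⊥M : Coprime q M) {k K : Vec ℤ 4} (k≡MK : k ≡ᵛ Vec.map (ℤ.+ M ℤ.*_) K mod q) where

    divisibility-transfer : q ℕ.∣ ∣ diagForm A k ∣ ⇔ q ℕ.∣ ∣ diagForm A K ∣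
    divisibility-transfer =
      ≡0-mod⇔∣ ⇔-∘ (≡0-mod-unit-scaling q⊥M (diagForm-≡-scaled A (ℤ.+ M) K k≡MK) ⇔-∘ ⇔-sym ≡0-mod⇔∣)

    χ-transfer : χ q (diagForm B k) ≡ χ q (diagForm B K)
    χ-transfer = χ-cong q (λ p-prime p∣q →
      legendre-unit-scaling (coprime-∣ˡ p∣q q⊥M) (≡-mod-∣ p∣q (diagForm-≡-scaled B (ℤ.+ M) K k≡MK))
        {{prime⇒nonZero p-prime}})

  phase-transfer : ∀ {q c M a aᵢ k K} → ℤ.+ a ℤ.* ℤ.+ M ≡ ℤ.+ aᵢ mod c →
    k ≡ᵛ Vec.map (ℤ.+ M ℤ.*_) K mod q ℕ.* c → diagForm A K ≡ ℤ.0ℤ mod q →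
    phase a k ≡ phase aᵢ K ℤ.* ℤ.+ M mod q ℕ.* c
  phase-transfer {q} {c} {M} {a} {aᵢ} {k} {K} aM≡aᵢ k≡MK ψ≡0 = begin
    ℤ.+ a ℤ.* diagForm A k ℤ.+ dot w k
      ≈⟨ +-cong-mod (*-congˡ-mod (ℤ.+ a) (diagForm-≡-scaled A (ℤ.+ M) K k≡MK)) (dot-≡-scaled w (ℤ.+ M) K k≡MK) ⟩
    ℤ.+ a ℤ.* (ℤ.+ M ℤ.* ℤ.+ M ℤ.* ψ) ℤ.+ ℤ.+ M ℤ.* δ
      ≡⟨ regroup (ℤ.+ a) (ℤ.+ M) ψ δ ⟩
    ψ ℤ.* (ℤ.+ a ℤ.* ℤ.+ M) ℤ.* ℤ.+ M ℤ.+ ℤ.+ M ℤ.* δ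
      ≈⟨ +-congʳ-mod (ℤ.+ M ℤ.* δ) (*-congʳ-mod (ℤ.+ M) (*-cong-mod-* ψ≡0 aM≡aᵢ)) ⟩
    ψ ℤ.* ℤ.+ aᵢ ℤ.* ℤ.+ M ℤ.+ ℤ.+ M ℤ.* δ
      ≡⟨ factor (ℤ.+ aᵢ) (ℤ.+ M) ψ δ ⟩
    (ℤ.+ aᵢ ℤ.* ψ ℤ.+ δ) ℤ.* ℤ.+ M ∎
    where
    open ≡-mod-Reasoning (q ℕ.* c)
    ψ δ : ℤ
    ψ = diagForm A K
    δ = dot w K
    regroup : ∀ a M ψ δ → a ℤ.* (M ℤ.* M ℤ.* ψ) ℤ.+ M ℤ.* δ ≡ ψ ℤ.* (a ℤ.* M) ℤ.* M ℤ.+ M ℤ.* δ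
    regroup = solve-∀
    factor : ∀ aᵢ M ψ δ → ψ ℤ.* aᵢ ℤ.* M ℤ.+ M ℤ.* δ ≡ (aᵢ ℤ.* ψ ℤ.+ δ) ℤ.* M
    factor = solve-∀

  module Splitting {q₁ q₂ c₁ c₂ : ℕ} (0<q : 0 < q₁ ℕ.* q₂) (0<c : 0 < c₁ ℕ.* c₂)
                   (M₁⊥M₂ : Coprime (q₁ ℕ.* c₁) (q₂ ℕ.* c₂)) where

    M₁ M₂ : ℕ
    M₁ = q₁ ℕ.* c₁
    M₂ = q₂ ℕ.* c₂

    instance
      _ : NonZero (q₁ ℕ.* q₂)
      _ = ℕ.>-nonZero 0<q
      _ : NonZero (c₁ ℕ.* c₂)
      _ = ℕ.>-nonZero 0<c
      q₁≢0 : NonZero q₁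
      q₁≢0 = ℕ.m*n≢0⇒m≢0 q₁
      q₂≢0 : NonZero q₂
      q₂≢0 = ℕ.m*n≢0⇒n≢0 q₁
      c₁≢0 : NonZero c₁
      c₁≢0 = ℕ.m*n≢0⇒m≢0 c₁
      c₂≢0 : NonZero c₂
      c₂≢0 = ℕ.m*n≢0⇒n≢0 c₁
      M₁≢0 : NonZero M₁
      M₁≢0 = ℕ.m*n≢0 q₁ c₁
      M₂≢0 : NonZero M₂
      M₂≢0 = ℕ.m*n≢0 q₂ c₂

    q₁⊥M₂ : Coprime q₁ M₂
    q₁⊥M₂ = coprime-∣ˡ (ℕ.m∣m*n c₁) M₁⊥M₂
    c₁⊥M₂ : Coprime c₁ M₂
    c₁⊥M₂ = coprime-∣ˡ (ℕ.n∣m*n q₁) M₁⊥M₂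
    q₂⊥M₁ : Coprime q₂ M₁
    q₂⊥M₁ = coprime-∣ˡ (ℕ.m∣m*n c₂) (ℕ.sym M₁⊥M₂)
    c₂⊥M₁ : Coprime c₂ M₁
    c₂⊥M₁ = coprime-∣ˡ (ℕ.n∣m*n q₂) (ℕ.sym M₁⊥M₂)
    q₁⊥q₂ : Coprime q₁ q₂
    q₁⊥q₂ = ℕ.sym (coprime-∣ˡ (ℕ.m∣m*n c₂) (ℕ.sym q₁⊥M₂))
    c₁⊥c₂ : Coprime c₁ c₂
    c₁⊥c₂ = ℕ.sym (coprime-∣ˡ (ℕ.n∣m*n q₂) (ℕ.sym c₁⊥M₂))

    -- Pᵃ = c₂ (c₂ M₂)⁻¹ vanishes mod c₂ and inverts M₂ mod c₁, so a ↦ a M₂ recovers the c₁-component.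
    private
      weight : ∀ {m n} (m⊥n : Coprime m n) {M} (m⊥M : Coprime m M) .{{_ : NonZero m}} →
        ∃ λ P → P ≡ ℤ.0ℤ mod n × P ℤ.* ℤ.+ M ≡ ℤ.1ℤ mod m
      weight {m} {n} m⊥n {M} m⊥M
        with U , nMU≡1 ← inverse-mod (ℕ.sym (Equivalence.from coprime-*⇔ (m⊥n , m⊥M))) =
        U ℤ.* ℤ.+ n , multiple-≡0-mod U , ≡-mod-trans (≡-mod-reflexive regroup) nMU≡1
        where
        regroup : U ℤ.* ℤ.+ n ℤ.* ℤ.+ M ≡ ℤ.+ (n ℕ.* M) ℤ.* U
        regroup = ≡.trans (ℤ.*-assoc U (ℤ.+ n) (ℤ.+ M))
          (≡.trans (≡.cong (U ℤ.*_) (≡.sym (ℤ.pos-* n M))) (ℤ.*-comm U (ℤ.+ (n ℕ.* M))))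

      weight₁ : ∃ λ P → P ≡ ℤ.0ℤ mod c₂ × P ℤ.* ℤ.+ M₂ ≡ ℤ.1ℤ mod c₁
      weight₁ = weight c₁⊥c₂ c₁⊥M₂
      weight₂ : ∃ λ Q → Q ≡ ℤ.0ℤ mod c₁ × Q ℤ.* ℤ.+ M₁ ≡ ℤ.1ℤ mod c₂
      weight₂ = weight (ℕ.sym c₁⊥c₂) c₂⊥M₁

    Pᵃ Qᵃ : ℤ
    Pᵃ = proj₁ weight₁
    Qᵃ = proj₁ weight₂

    module CRTᵃ = CRT c₁⊥c₂ {Pᵃ} {Qᵃ} (proj₁ (proj₂ weight₁)) (proj₁ (proj₂ weight₂))
                                     (proj₂ (proj₂ weight₁)) (proj₂ (proj₂ weight₂))
    module CRTᵏ = CRT M₁⊥M₂ {ℤ.+ M₂} {ℤ.+ M₁} self-≡0-mod self-≡0-mod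
      (proj₂ (inverse-mod (ℕ.sym M₁⊥M₂))) (proj₂ (inverse-mod M₁⊥M₂))

    q*c≡M₁*M₂ : q₁ ℕ.* q₂ ℕ.* (c₁ ℕ.* c₂) ≡ M₁ ℕ.* M₂
    q*c≡M₁*M₂ = interchange q₁ q₂ c₁ c₂
      where open import Algebra.Properties.CommutativeSemigroup ℕ.*-commutativeSemigroup using (interchange)

    crtᵛ : ∀ {d} → Vec ℕ d → Vec ℕ d → Vec ℤ d
    crtᵛ u v = fromℕᵛ (zipWith CRTᵏ.crt u v)

    crtᵛ-≡ˡ : ∀ {d} (u v : Vec ℕ d) → crtᵛ u v ≡ᵛ Vec.map (ℤ.+ M₂ ℤ.*_) (fromℕᵛ u) mod M₁
    crtᵛ-≡ˡ []      []      = []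
    crtᵛ-≡ˡ (x ∷ u) (y ∷ v) = CRTᵏ.crt-≡ˡ x y ∷ crtᵛ-≡ˡ u v

    crtᵛ-≡ʳ : ∀ {d} (u v : Vec ℕ d) → crtᵛ u v ≡ᵛ Vec.map (ℤ.+ M₁ ℤ.*_) (fromℕᵛ v) mod M₂
    crtᵛ-≡ʳ []      []      = []
    crtᵛ-≡ʳ (x ∷ u) (y ∷ v) = CRTᵏ.crt-≡ʳ x y ∷ crtᵛ-≡ʳ u v

    coprime-crtᵃ : ∀ a₁ a₂ → gcd (CRTᵃ.crt a₁ a₂) (c₁ ℕ.* c₂) ≡ 1 ⇔ (gcd a₁ c₁ ≡ 1 × gcd a₂ c₂ ≡ 1)
    coprime-crtᵃ a₁ a₂ =
      (⇔-sym gcd≡1⇔coprime ×-⇔ ⇔-sym gcd≡1⇔coprime) ⇔-∘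
      ((transfer Pᵃ (CRTᵃ.crt-≡ˡ a₁ a₂) (CRTᵃ.crt-projˡ a₁ a₂) ×-⇔
        transfer Qᵃ (CRTᵃ.crt-≡ʳ a₁ a₂) (CRTᵃ.crt-projʳ a₁ a₂)) ⇔-∘
      (coprime-*⇔ ⇔-∘ gcd≡1⇔coprime))
      where
      transfer : ∀ {a aᵢ c M} P → ℤ.+ a ≡ P ℤ.* ℤ.+ aᵢ mod c → ℤ.+ a ℤ.* ℤ.+ M ≡ ℤ.+ aᵢ mod c →
        Coprime a c ⇔ Coprime aᵢ c
      transfer {a} {aᵢ} {M = M} P a≡Paᵢ aM≡aᵢ = mk⇔ (coprime-transfer P a≡Paᵢ)
        (coprime-transfer (ℤ.+ M)
          (≡-mod-trans (≡-mod-sym aM≡aᵢ) (≡-mod-reflexive (ℤ.*-comm (ℤ.+ a) (ℤ.+ M)))))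

    divisibility-crtᵏ : ∀ k₁ k₂ → q₁ ℕ.* q₂ ℕ.∣ ∣ diagForm A (crtᵛ k₁ k₂) ∣ ⇔
      (q₁ ℕ.∣ ∣ diagForm A (fromℕᵛ k₁) ∣ × q₂ ℕ.∣ ∣ diagForm A (fromℕᵛ k₂) ∣)
    divisibility-crtᵏ k₁ k₂ =
      (divisibility-transfer q₁⊥M₂ (≡ᵛ-mod-∣ (ℕ.m∣m*n c₁) (crtᵛ-≡ˡ k₁ k₂)) ×-⇔
       divisibility-transfer q₂⊥M₁ (≡ᵛ-mod-∣ (ℕ.m∣m*n c₂) (crtᵛ-≡ʳ k₁ k₂))) ⇔-∘
      mk⇔ (λ q₁q₂∣ψ → ℕ.m*n∣⇒m∣ q₁ q₂ q₁q₂∣ψ , ℕ.m*n∣⇒n∣ q₁ q₂ q₁q₂∣ψ)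
          (λ (q₁∣ψ , q₂∣ψ) → *-∣-coprime q₁⊥q₂ q₁∣ψ q₂∣ψ)

    χ-crtᵏ : ∀ k₁ k₂ →
      χ (q₁ ℕ.* q₂) (diagForm B (crtᵛ k₁ k₂)) ≡ χ q₁ (diagForm B (fromℕᵛ k₁)) ℤ.* χ q₂ (diagForm B (fromℕᵛ k₂))
    χ-crtᵏ k₁ k₂ = ≡.trans (χ-* q₁⊥q₂ (diagForm B (crtᵛ k₁ k₂))) (≡.cong₂ ℤ._*_
      (χ-transfer q₁⊥M₂ (≡ᵛ-mod-∣ (ℕ.m∣m*n c₁) (crtᵛ-≡ˡ k₁ k₂)))
      (χ-transfer q₂⊥M₁ (≡ᵛ-mod-∣ (ℕ.m∣m*n c₂) (crtᵛ-≡ʳ k₁ k₂))))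

    phase-crt : ∀ a₁ a₂ k₁ k₂ → diagForm A (fromℕᵛ k₁) ≡ ℤ.0ℤ mod q₁ → diagForm A (fromℕᵛ k₂) ≡ ℤ.0ℤ mod q₂ →
      phase (CRTᵃ.crt a₁ a₂) (crtᵛ k₁ k₂) ≡
        phase a₁ (fromℕᵛ k₁) ℤ.* ℤ.+ M₂ ℤ.+ phase a₂ (fromℕᵛ k₂) ℤ.* ℤ.+ M₁ mod M₁ ℕ.* M₂
    phase-crt a₁ a₂ k₁ k₂ ψ₁≡0 ψ₂≡0 = ≡-mod-*-coprime M₁⊥M₂
      (≡-mod-trans (phase-transfer {a = a} {a₁} (CRTᵃ.crt-projˡ a₁ a₂) (crtᵛ-≡ˡ k₁ k₂) ψ₁≡0)
                   (≡-mod-sym (+-multiple-≡-mod (X₁ ℤ.* ℤ.+ M₂) X₂)))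
      (≡-mod-trans (phase-transfer {a = a} {a₂} (CRTᵃ.crt-projʳ a₁ a₂) (crtᵛ-≡ʳ k₁ k₂) ψ₂≡0)
                   (≡-mod-sym (multiple-+-≡-mod X₁ (X₂ ℤ.* ℤ.+ M₁))))
      where
      a : ℕ
      a = CRTᵃ.crt a₁ a₂
      X₁ X₂ : ℤ
      X₁ = phase a₁ (fromℕᵛ k₁)
      X₂ = phase a₂ (fromℕᵛ k₂)

    term-crt : ∀ a₁ a₂ k₁ k₂ → diagForm A (fromℕᵛ k₁) ≡ ℤ.0ℤ mod q₁ → diagForm A (fromℕᵛ k₂) ≡ ℤ.0ℤ mod q₂ →
      term (q₁ ℕ.* q₂) (c₁ ℕ.* c₂) (CRTᵃ.crt a₁ a₂) (crtᵛ k₁ k₂) ≈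
        term q₁ c₁ a₁ (fromℕᵛ k₁) * term q₂ c₂ a₂ (fromℕᵛ k₂)
    term-crt a₁ a₂ k₁ k₂ ψ₁≡0 ψ₂≡0 = begin
      fromℤ R (χ (q₁ ℕ.* q₂) (diagForm B k)) * e (frac (phase a k) (q₁ ℕ.* q₂ ℕ.* (c₁ ℕ.* c₂)))
        ≡⟨ ≡.cong₂ (λ x N → fromℤ R x * e (frac (phase a k) N)) (χ-crtᵏ k₁ k₂) q*c≡M₁*M₂ ⟩
      fromℤ R (χ₁ ℤ.* χ₂) * e (frac (phase a k) (M₁ ℕ.* M₂))
        ≈⟨ *-cong (fromℤ-* R χ₁ χ₂)
             (e-frac-split R e-char (ℕ.>-nonZero⁻¹ M₁) (ℕ.>-nonZero⁻¹ M₂) _ _ (phase-crt a₁ a₂ k₁ k₂ ψ₁≡0 ψ₂≡0)) ⟩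
      (fromℤ R χ₁ * fromℤ R χ₂) * (e (frac (phase a₁ K₁) M₁) * e (frac (phase a₂ K₂) M₂))
        ≈⟨ interchange _ _ _ _ ⟩
      (fromℤ R χ₁ * e (frac (phase a₁ K₁) M₁)) * (fromℤ R χ₂ * e (frac (phase a₂ K₂) M₂)) ∎
      where
      open ≈-Reasoning
      open import Algebra.Properties.CommutativeSemigroup *-commutativeSemigroup using (interchange)
      a : ℕ
      a = CRTᵃ.crt a₁ a₂
      k K₁ K₂ : Vec ℤ 4
      k = crtᵛ k₁ k₂
      K₁ = fromℕᵛ k₁
      K₂ = fromℕᵛ k₂
      χ₁ χ₂ : ℤ
      χ₁ = χ q₁ (diagForm B K₁)
      χ₂ = χ q₂ (diagForm B K₂)

    summand-crt : ∀ a₁ a₂ k₁ k₂ →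
      summand (q₁ ℕ.* q₂) (c₁ ℕ.* c₂) (CRTᵃ.crt a₁ a₂) (crtᵛ k₁ k₂) ≈
        summand q₁ c₁ a₁ (fromℕᵛ k₁) * summand q₂ c₂ a₂ (fromℕᵛ k₂)
    summand-crt a₁ a₂ k₁ k₂ = begin
      𝟙 R (does (gcd a (c₁ ℕ.* c₂) ℕ.≟ 1)) * (𝟙 R (does (q₁ ℕ.* q₂ ℕ.∣? ∣ diagForm A k ∣)) * t)
        ≡⟨ ≡.cong₂ (λ g d → 𝟙 R g * (𝟙 R d * t))
             (does-⇔ (coprime-crtᵃ a₁ a₂) (gcd a (c₁ ℕ.* c₂) ℕ.≟ 1) (gcd a₁ c₁ ℕ.≟ 1 ×-dec gcd a₂ c₂ ℕ.≟ 1))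
             (does-⇔ (divisibility-crtᵏ k₁ k₂) (q₁ ℕ.* q₂ ℕ.∣? ∣ diagForm A k ∣) (q₁∣ψ₁? K₁ ×-dec q₂∣ψ₁? K₂)) ⟩
      𝟙 R (does (gcd a₁ c₁ ℕ.≟ 1) ∧ does (gcd a₂ c₂ ℕ.≟ 1)) * (𝟙 R (does (q₁∣ψ₁? K₁) ∧ does (q₂∣ψ₁? K₂)) * t)
        ≈⟨ 𝟙-∧-* R _ _ (λ _ _ → 𝟙-∧-* R _ _ (λ d₁ d₂ → term-crt a₁ a₂ k₁ k₂ (≡0-mod d₁) (≡0-mod d₂))) ⟩
      summand q₁ c₁ a₁ K₁ * summand q₂ c₂ a₂ K₂ ∎
      where
      open ≈-Reasoning
      a : ℕ
      a = CRTᵃ.crt a₁ a₂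
      k K₁ K₂ : Vec ℤ 4
      k = crtᵛ k₁ k₂
      K₁ = fromℕᵛ k₁
      K₂ = fromℕᵛ k₂
      t : Carrier
      t = term (q₁ ℕ.* q₂) (c₁ ℕ.* c₂) a k
      q₁∣ψ₁? : (K : Vec ℤ 4) → Dec (q₁ ℕ.∣ ∣ diagForm A K ∣)
      q₁∣ψ₁? K = q₁ ℕ.∣? ∣ diagForm A K ∣
      q₂∣ψ₁? : (K : Vec ℤ 4) → Dec (q₂ ℕ.∣ ∣ diagForm A K ∣)
      q₂∣ψ₁? K = q₂ ℕ.∣? ∣ diagForm A K ∣
      ≡0-mod : ∀ {q K} → T (does (q ℕ.∣? ∣ diagForm A K ∣)) → diagForm A K ≡ ℤ.0ℤ mod q
      ≡0-mod {q} {K} d = Equivalence.from ≡0-mod⇔∣ (Equivalence.to (T-does⇔ (q ℕ.∣? ∣ diagForm A K ∣)) d)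

open import Data.Nat.Base using (_*_)
open import Data.Nat.GCD using (gcd)
open import Data.Nat.Coprimality using (gcd≡1⇒coprime)
import Relation.Binary.Reasoning.Setoid as SetoidReasoning

lemma5p1 : ∀ {c ℓ : Level} (R : CommutativeRing c ℓ) (e : ℚ → CommutativeRing.Carrier R) →
    IsAddChar R e →
    (A B w : Vec ℤ 4) (q₁ q₂ c₁ c₂ : ℕ) →
    SquareFree (q₁ * q₂) → 0 < q₁ * q₂ → 0 < c₁ * c₂ →
    gcd (q₁ * c₁) (q₂ * c₂) ≡ 1 →
    CommutativeRing._≈_ R (S R e A B (q₁ * q₂) (c₁ * c₂) w)
      (CommutativeRing._*_ R (S R e A B q₁ c₁ w) (S R e A B q₂ c₂ w))
lemma5p1 R e e-char A B w q₁ q₂ c₁ c₂ _ 0<q 0<c gcd≡1 = begin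
  S R e A B (q₁ * q₂) (c₁ * c₂) w
    ≈⟨ S≈∑summand (q₁ * q₂) (c₁ * c₂) ⟩
  ∑< R (c₁ * c₂) (λ a → ∑box R 4 (q₁ * q₂ * (c₁ * c₂)) (s a))
    ≡⟨ ≡.cong (λ N → ∑< R (c₁ * c₂) (λ a → ∑box R 4 N (s a))) q*c≡M₁*M₂ ⟩
  ∑< R (c₁ * c₂) (λ a → ∑box R 4 (M₁ * M₂) (s a))
    ≈⟨ CRTᵃ.∑<-crt R (λ a → ∑box R 4 (M₁ * M₂) (s a)) ⟩
  ∑< R c₁ (λ a₁ → ∑< R c₂ (λ a₂ → ∑box R 4 (M₁ * M₂) (s (CRTᵃ.crt a₁ a₂))))
    ≈⟨ ∑<-cong R c₁ (λ {a₁} _ → ∑<-cong R c₂ (λ {a₂} _ → CRTᵏ.∑box-crt R 4 (s (CRTᵃ.crt a₁ a₂)))) ⟩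
  ∑< R c₁ (λ a₁ → ∑< R c₂ (λ a₂ → ∑box R 4 M₁ (λ k₁ → ∑box R 4 M₂ (λ k₂ →
    summand (q₁ * q₂) (c₁ * c₂) (CRTᵃ.crt a₁ a₂) (crtᵛ k₁ k₂)))))
    ≈⟨ ∑<-cong R c₁ (λ {a₁} _ → ∑<-cong R c₂ (λ {a₂} _ →
         ∑box-cong R 4 M₁ (λ k₁ → ∑box-cong R 4 M₂ (λ k₂ → summand-crt a₁ a₂ k₁ k₂)))) ⟩
  ∑< R c₁ (λ a₁ → ∑< R c₂ (λ a₂ → ∑box R 4 M₁ (λ k₁ → ∑box R 4 M₂ (λ k₂ → s₁ a₁ k₁ · s₂ a₂ k₂))))
    ≈⟨ ∑<-∑box-* R c₁ c₂ 4 M₁ M₂ s₁ s₂ ⟩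
  ∑< R c₁ (λ a → ∑box R 4 M₁ (s₁ a)) · ∑< R c₂ (λ a → ∑box R 4 M₂ (s₂ a))
    ≈⟨ *-cong (S≈∑summand q₁ c₁) (S≈∑summand q₂ c₂) ⟨
  S R e A B q₁ c₁ w · S R e A B q₂ c₂ w ∎
  where
  open CommutativeRing R using (Carrier; setoid; *-cong) renaming (_*_ to _·_)
  open SetoidReasoning setoid
  open ExponentialSum R e-char A B w
  open Splitting {q₁} {q₂} {c₁} {c₂} 0<q 0<c (gcd≡1⇒coprime gcd≡1)
  s s₁ s₂ : ℕ → Vec ℕ 4 → Carrier
  s a = summand (q₁ * q₂) (c₁ * c₂) a ∘ fromℕᵛ
  s₁ a = summand q₁ c₁ a ∘ fromℕᵛ
  s₂ a = summand q₂ c₂ a ∘ fromℕᵛ
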